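{- Let $q$ be a power of $2$, $U=V(n,q)$ with a nondegenerate symmetric bilinear form $\mathsf b$, and let $\Xi\subseteq\mathrm{End}(U)$ be a set of self-adjoint operators containing $0$. Equip $V=U\oplus U$ with the alternating form $((x,y),(x',y'))=\mathsf b(x,y')+\mathsf b(y,x')$ and the quadratic form $Q((x,y))=\mathsf b(x,y)$, and put $V(L)=\{(x,xL)\mid x\in U\}$. (a) If $|\Xi|=q^n$ and $\det(L+L')\neq0$ for all distinct $L,L'\in\Xi$, then $\{V(L)\mid L\in\Xi\}\cup\{0\oplus U\}$ is a symplectic spread of $V$. (b) If $|\Xi|=q^{n-1}$, $\det(L+L')\neq0$ for all distinct $L,L'\in\Xi$, and all members of $\Xi$ are skew-symmetric, then $\{V(L)\mid L\in\Xi\}\cup\{0\oplus U\}$ is an orthogonal spread of $V$. (c) Suppose $q=2$, $n$ is odd, $|\Xi|=2^n$, all members of $\Xi$ are skew-symmetric, and (1) $\mathrm{rk}(L+L')=n-1$ for all distinct $L,L'\in\Xi$, and (2) for each $L\in\Xi$, $\{\ker(L+L')\mid L'\in\Xi-\{L\}\}$ is the set of all $1$-dimensional subspaces of $U$. Then $\{V(L)\mid L\in\Xi\}$ is an orthogonal dual hyperoval of $(V,Q)$ that splits over $0\oplus U$.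
   Context: Operators act on the right. $L$ is self-adjoint if $\mathsf b(xL,y)=\mathsf b(x,yL)$ for all $x,y$, and skew-symmetric if moreover $\mathsf b(x,xL)=0$ for all $x$. A symplectic spread of $V$ is a set of $q^n+1$ $n$-dimensional subspaces, totally isotropic for the alternating form, such that every nonzero vector lies in exactly one of them. An orthogonal spread is a set of totally singular $n$-dimensional subspaces (for $Q$) such that every nonzero singular vector lies in exactly one of them. A dual hyperoval of rank $n$ over $\mathbb F_2$ is a set of $2^n$ $n$-dimensional subspaces spanning $V$, any two meeting in a 1-dimensional subspace and any three meeting in $0$; it is orthogonal if all members are totally singular, and splits over $Y$ if $V=X\oplus Y$ for every member $X$. -}

module Defs where

open import Level using (0ℓ)
open import Algebra.Bundles using (CommutativeRing)
open import Data.Nat using (ℕ; zero; suc; _^_) renaming (_+_ to _+ℕ_)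
open import Data.Fin using (Fin; zero; suc; punchIn)
open import Data.Product using (Σ; ∃; _×_; _,_)
open import Relation.Nullary using (¬_)
open import Relation.Binary.PropositionalEquality using (_≡_; _≢_)

record IsField (R : CommutativeRing 0ℓ 0ℓ) : Set where
  open CommutativeRing R using (_≈_; _*_; 0#; 1#)
  field
    1≉0 : ¬ (1# ≈ 0#)
    inv : ∀ x → ¬ (x ≈ 0#) → ∃ λ y → x * y ≈ 1#

module LinAlg (R : CommutativeRing 0ℓ 0ℓ) where
  open CommutativeRing R using (_≈_; _+_; _*_; -_; 0#; 1#) renaming (Carrier to F)

  HasCard : ℕ → Set
  HasCard q = Σ (Fin q → F) λ e → (∀ i j → e i ≈ e j → i ≡ j) × (∀ x → ∃ λ i → e i ≈ x)

  NonZeroF : F → Set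
  NonZeroF x = ¬ (x ≈ 0#)

  Char2 : Set
  Char2 = 1# + 1# ≈ 0#

  ∑ : ∀ {n} → (Fin n → F) → F
  ∑ {zero} f = 0#
  ∑ {suc n} f = f zero + ∑ (λ i → f (suc i))

  -- U = V(n,q) as row vectors; operators as n×n matrices acting on the right
  Vect : ℕ → Set
  Vect n = Fin n → F

  Mat : ℕ → Set
  Mat n = Fin n → Fin n → F

  module _ {n : ℕ} where
    _≈ᵥ_ : Vect n → Vect n → Set
    x ≈ᵥ y = ∀ i → x i ≈ y i

    0ᵥ : Vect n
    0ᵥ _ = 0#

    _+ᵥ_ : Vect n → Vect n → Vect n
    (x +ᵥ y) i = x i + y i

    _·ᵥ_ : F → Vect n → Vect n
    (c ·ᵥ x) i = c * x i

    _≈ₘ_ : Mat n → Mat n → Set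
    L ≈ₘ M = ∀ i j → L i j ≈ M i j

    0ₘ : Mat n
    0ₘ _ _ = 0#

    _+ₘ_ : Mat n → Mat n → Mat n
    (L +ₘ M) i j = L i j + M i j

    _▷_ : Vect n → Mat n → Vect n
    (x ▷ L) j = ∑ λ i → x i * L i j

  sgn : ∀ {n} → Fin n → F
  sgn zero = 1#
  sgn (suc j) = - sgn j

  det : ∀ {n} → Mat n → F
  det {zero} M = 1#
  det {suc n} M = ∑ λ j → sgn j * (M zero j * det (λ r c → M (suc r) (punchIn j c)))

  bf : ∀ {n} → Mat n → Vect n → Vect n → F
  bf B x y = ∑ λ i → ∑ λ j → x i * (B i j * y j)

  Symmetric : ∀ {n} → Mat n → Set
  Symmetric B = ∀ i j → B i j ≈ B j i

  Nondegenerate : ∀ {n} → Mat n → Set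
  Nondegenerate B = ∀ x → (∀ y → bf B x y ≈ 0#) → x ≈ᵥ 0ᵥ

  SelfAdjoint : ∀ {n} → Mat n → Mat n → Set
  SelfAdjoint B L = ∀ x y → bf B (x ▷ L) y ≈ bf B x (y ▷ L)

  SkewSymmetric : ∀ {n} → Mat n → Mat n → Set
  SkewSymmetric B L = SelfAdjoint B L × (∀ x → bf B x (x ▷ L) ≈ 0#)

  record Space : Set₁ where
    field
      Pt   : Set
      _≅_  : Pt → Pt → Set
      𝟎    : Pt
      _⊕_  : Pt → Pt → Pt
      _⊙_  : F → Pt → Pt

  module Sp (S : Space) where
    open Space S

    Sub : Set₁
    Sub = Pt → Set

    lin : ∀ {d} → (Fin d → F) → (Fin d → Pt) → Pt
    lin {zero} c b = 𝟎
    lin {suc d} c b = (c zero ⊙ b zero) ⊕ lin (λ i → c (suc i)) (λ i → b (suc i))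

    sumPt : ∀ {d} → (Fin d → Pt) → Pt
    sumPt {zero} w = 𝟎
    sumPt {suc d} w = w zero ⊕ sumPt (λ i → w (suc i))

    LinIndep : ∀ {d} → (Fin d → Pt) → Set
    LinIndep b = ∀ c → lin c b ≅ 𝟎 → ∀ i → c i ≈ 0#

    InSpan : ∀ {d} → (Fin d → Pt) → Pt → Set
    InSpan b v = ∃ λ c → v ≅ lin c b

    HasDim : Sub → ℕ → Set
    HasDim P d = Σ (Fin d → Pt) λ b → LinIndep b × (∀ v → P v → InSpan b v) × (∀ v → InSpan b v → P v)

    SameSet : Sub → Sub → Set
    SameSet P P' = (∀ v → P v → P' v) × (∀ v → P' v → P v)

    _∩_ : Sub → Sub → Sub
    (P ∩ P') v = P v × P' v

  USpace : ℕ → Space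
  USpace n = record { Pt = Vect n ; _≅_ = _≈ᵥ_ ; 𝟎 = 0ᵥ ; _⊕_ = _+ᵥ_ ; _⊙_ = _·ᵥ_ }

  VPt : ℕ → Set
  VPt n = Vect n × Vect n

  VSpace : ℕ → Space
  VSpace n = record
    { Pt = VPt n
    ; _≅_ = λ { (x , y) (x' , y') → (x ≈ᵥ x') × (y ≈ᵥ y') }
    ; 𝟎 = (0ᵥ , 0ᵥ)
    ; _⊕_ = λ { (x , y) (x' , y') → (x +ᵥ x' , y +ᵥ y') }
    ; _⊙_ = λ { c (x , y) → (c ·ᵥ x , c ·ᵥ y) }
    }

  module U {n : ℕ} = Sp (USpace n)
  module V {n : ℕ} = Sp (VSpace n)

  _≅V_ : ∀ {n} → VPt n → VPt n → Set
  _≅V_ {n} = Space._≅_ (VSpace n)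

  0V : ∀ {n} → VPt n
  0V = (0ᵥ , 0ᵥ)

  _+V_ : ∀ {n} → VPt n → VPt n → VPt n
  _+V_ {n} = Space._⊕_ (VSpace n)

  alt : ∀ {n} → Mat n → VPt n → VPt n → F
  alt B (x , y) (x' , y') = bf B x y' + bf B y x'

  Qf : ∀ {n} → Mat n → VPt n → F
  Qf B (x , y) = bf B x y

  VL : ∀ {n} → Mat n → VPt n → Set
  VL L (x , y) = y ≈ᵥ (x ▷ L)

  0⊕U : ∀ {n} → VPt n → Set
  0⊕U (x , y) = x ≈ᵥ 0ᵥ

  HasRank : ∀ {n} → Mat n → ℕ → Set
  HasRank {n} L r = U.HasDim (λ y → ∃ λ x → y ≈ᵥ (x ▷ L)) r

  ker : ∀ {n} → Mat n → Vect n → Set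
  ker L x = (x ▷ L) ≈ᵥ 0ᵥ

  -- spreads and dual hyperovals, for a family S : Fin k → subsets of V
  -- (a family without repetitions represents a set of k subspaces)

  Distinct : ∀ {n k} → (Fin k → VPt n → Set) → Set
  Distinct S = ∀ i j → V.SameSet (S i) (S j) → i ≡ j

  SymplecticSpread : ∀ {n k} → ℕ → Mat n → (Fin k → VPt n → Set) → Set
  SymplecticSpread {n} {k} q B S =
      (k ≡ q ^ n +ℕ 1)
    × Distinct S
    × (∀ i → V.HasDim (S i) n)
    × (∀ i v w → S i v → S i w → alt B v w ≈ 0#)
    × (∀ v → ¬ (v ≅V 0V) → ∃ λ i → S i v)
    × (∀ v i j → ¬ (v ≅V 0V) → S i v → S j v → i ≡ j)

  OrthogonalSpread : ∀ {n k} → Mat n → (Fin k → VPt n → Set) → Set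
  OrthogonalSpread {n} {k} B S =
      Distinct S
    × (∀ i → V.HasDim (S i) n)
    × (∀ i v → S i v → Qf B v ≈ 0#)
    × (∀ v → ¬ (v ≅V 0V) → Qf B v ≈ 0# → ∃ λ i → S i v)
    × (∀ v i j → ¬ (v ≅V 0V) → Qf B v ≈ 0# → S i v → S j v → i ≡ j)

  DualHyperoval : ∀ {n k} → (Fin k → VPt n → Set) → Set
  DualHyperoval {n} {k} S =
      (k ≡ 2 ^ n)
    × Distinct S
    × (∀ i → V.HasDim (S i) n)
    × (∀ v → ∃ λ (w : Fin k → VPt n) → (∀ i → S i (w i)) × (v ≅V V.sumPt w))
    × (∀ i j → i ≢ j → V.HasDim (V._∩_ (S i) (S j)) 1)
    × (∀ i j l → i ≢ j → j ≢ l → i ≢ l → ∀ v → S i v → S j v → S l v → v ≅V 0V)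

  OrthogonalDualHyperoval : ∀ {n k} → Mat n → (Fin k → VPt n → Set) → Set
  OrthogonalDualHyperoval B S = DualHyperoval S × (∀ i v → S i v → Qf B v ≈ 0#)

  SplitsOver : ∀ {n k} → (Fin k → VPt n → Set) → (VPt n → Set) → Set
  SplitsOver {n} S Y = ∀ i →
      (∀ v → ∃ λ x → ∃ λ y → S i x × Y y × (v ≅V (x +V y)))
    × (∀ v → S i v → Y v → v ≅V 0V)

  withVertical : ∀ {n N} → (Fin N → Mat n) → Fin (suc N) → VPt n → Set
  withVertical Ξ zero = 0⊕U
  withVertical Ξ (suc i) = VL (Ξ i)

-- In characteristic 2, V(L) ∩ V(L') is the graph of L over ker (L + L'). In (a) and (b) a nonsingular L + L'
-- therefore makes the members meet trivially: for x ≠ 0 the map L ↦ x L is injective on Ξ, with values in U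
-- (q^n vectors), resp. for skew L in x^⊥ (q^(n-1) vectors), so by counting it is onto and every nonzero, resp.
-- singular, vector is covered. Nonsingularity enters through det = permanent in characteristic 2: the permanent
-- vanishes on a matrix with two equal rows, hence on one with a nonzero kernel vector.
-- In (c) the same formula gives the 1-dimensional pairwise meets; counting the lines of U against Ξ - {L} makes the
-- kernels ker (L + L') pairwise distinct, so three members meet trivially. Finally, with 0 ∈ Ξ, every y is
-- orthogonal to some p ≠ 0 spanning ker L' for an L' ∈ Ξ; self-adjointness and rank n - 1 give Im L' = p^⊥ ∋ y,
-- so (x, y) = (a, a L') + (x + a, 0) is a sum of members.
module Submission where

open import Defs
open import Level using (0ℓ)
open import Algebra.Bundles using (CommutativeRing)
open import Data.Nat using (ℕ; zero; suc; _^_; _≤_; _∸_; s≤s; z≤n)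
import Data.Nat.Properties as ℕ
open import Data.Fin using (Fin; zero; suc; punchIn; punchOut; lift; combine; remQuot)
open import Data.Fin.Properties
  using (_≟_; any?; all?; ¬∀⟶∃¬; injective⇒≤; punchOut-injective; punchIn-punchOut;
         combine-injectiveˡ; combine-injectiveʳ; combine-remQuot)
open import Data.Product using (∃; _×_; _,_; proj₁; proj₂)
open import Data.Sum using (_⊎_; inj₁; inj₂)
open import Data.Unit using (⊤; tt)
open import Data.Vec.Functional using (_∷_)
open import Function.Definitions using (Injective)
open import Relation.Binary.Definitions using (Decidable)
open import Relation.Binary.PropositionalEquality as ≡ using (_≡_; _≢_)
open import Relation.Nullary using (¬_; Dec; yes; no; contradiction)

module RingLemmas (R : CommutativeRing 0ℓ 0ℓ) where
  open CommutativeRing R renaming (Carrier to F) hiding (zero)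
  open LinAlg R
  open import Relation.Binary.Reasoning.Setoid setoid
  open import Algebra.Properties.CommutativeSemigroup +-commutativeSemigroup
    using (interchange) renaming (x∙yz≈y∙xz to +-exchange)
  open import Algebra.Properties.CommutativeSemigroup *-commutativeSemigroup
    using () renaming (x∙yz≈y∙xz to *-exchange) public

  ∑-cong : ∀ {n} {f g : Fin n → F} → (∀ i → f i ≈ g i) → ∑ f ≈ ∑ g
  ∑-cong {zero} f≈g = refl
  ∑-cong {suc n} f≈g = +-cong (f≈g zero) (∑-cong (λ i → f≈g (suc i)))

  ∑-zero : ∀ {n} {f : Fin n → F} → (∀ i → f i ≈ 0#) → ∑ f ≈ 0#
  ∑-zero {zero} f≈0 = refl
  ∑-zero {suc n} f≈0 = trans (+-cong (f≈0 zero) (∑-zero (λ i → f≈0 (suc i)))) (+-identityˡ 0#)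

  ∑-distrib-+ : ∀ {n} (f g : Fin n → F) → ∑ (λ i → f i + g i) ≈ ∑ f + ∑ g
  ∑-distrib-+ {zero} f g = sym (+-identityˡ 0#)
  ∑-distrib-+ {suc n} f g =
    trans (+-congˡ (∑-distrib-+ (λ i → f (suc i)) (λ i → g (suc i)))) (interchange _ _ _ _)

  *-distribˡ-∑ : ∀ {n} c (f : Fin n → F) → ∑ (λ i → c * f i) ≈ c * ∑ f
  *-distribˡ-∑ {zero} c f = sym (zeroʳ c)
  *-distribˡ-∑ {suc n} c f =
    trans (+-congˡ (*-distribˡ-∑ c (λ i → f (suc i)))) (sym (distribˡ c _ _))

  *-distribʳ-∑ : ∀ {n} c (f : Fin n → F) → ∑ (λ i → f i * c) ≈ ∑ f * c
  *-distribʳ-∑ c f = trans (∑-cong (λ i → *-comm (f i) c)) (trans (*-distribˡ-∑ c f) (*-comm c _))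

  ∑-comm : ∀ {m n} (f : Fin m → Fin n → F) → ∑ (λ i → ∑ (f i)) ≈ ∑ (λ j → ∑ (λ i → f i j))
  ∑-comm {zero} {n} f = sym (∑-zero {n} (λ j → refl))
  ∑-comm {suc m} f =
    trans (+-congˡ (∑-comm (λ i → f (suc i)))) (sym (∑-distrib-+ (f zero) _))

  ∑-punchIn : ∀ {n} (j : Fin (suc n)) (f : Fin (suc n) → F) → ∑ f ≈ f j + ∑ (λ k → f (punchIn j k))
  ∑-punchIn zero f = refl
  ∑-punchIn {suc n} (suc j) f =
    trans (+-congˡ (∑-punchIn j (λ i → f (suc i)))) (+-exchange (f zero) (f (suc j)) _)

  δ : ∀ {n} → Fin n → Fin n → F
  δ zero zero = 1#
  δ zero (suc _) = 0#
  δ (suc _) zero = 0#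
  δ (suc r) (suc i) = δ r i

  δ-diag : ∀ {n} (r : Fin n) → δ r r ≈ 1#
  δ-diag zero = refl
  δ-diag (suc r) = δ-diag r

  δ-off : ∀ {n} {r t : Fin n} → r ≢ t → δ r t ≈ 0#
  δ-off {r = zero} {zero} r≢t = contradiction ≡.refl r≢t
  δ-off {r = zero} {suc t} r≢t = refl
  δ-off {r = suc r} {zero} r≢t = refl
  δ-off {r = suc r} {suc t} r≢t = δ-off (λ r≡t → r≢t (≡.cong suc r≡t))

  ∑-δˡ : ∀ {n} (r : Fin n) (f : Fin n → F) → ∑ (λ i → δ r i * f i) ≈ f r
  ∑-δˡ {suc n} zero f =
    trans (+-cong (*-identityˡ _) (∑-zero (λ i → zeroˡ (f (suc i))))) (+-identityʳ _)
  ∑-δˡ {suc n} (suc r) f = trans (+-cong (zeroˡ _) (∑-δˡ r (λ i → f (suc i)))) (+-identityˡ _)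

  ∑-δʳ : ∀ {n} (f : Fin n → F) (r : Fin n) → ∑ (λ i → f i * δ i r) ≈ f r
  ∑-δʳ {suc n} f zero =
    trans (+-cong (*-identityʳ _) (∑-zero (λ i → zeroʳ (f (suc i))))) (+-identityʳ _)
  ∑-δʳ {suc n} f (suc r) = trans (+-cong (zeroʳ _) (∑-δʳ (λ i → f (suc i)) r)) (+-identityˡ _)

  ▷-cong : ∀ {n} {x y : Vect n} {L M : Mat n} → x ≈ᵥ y → L ≈ₘ M → (x ▷ L) ≈ᵥ (y ▷ M)
  ▷-cong x≈y L≈M j = ∑-cong (λ i → *-cong (x≈y i) (L≈M i j))

  ▷-congˡ : ∀ {n} {x y : Vect n} (L : Mat n) → x ≈ᵥ y → (x ▷ L) ≈ᵥ (y ▷ L)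
  ▷-congˡ L x≈y = ▷-cong x≈y (λ _ _ → refl)

  ▷-congʳ : ∀ {n} (x : Vect n) {L M : Mat n} → L ≈ₘ M → (x ▷ L) ≈ᵥ (x ▷ M)
  ▷-congʳ x L≈M = ▷-cong (λ _ → refl) L≈M

  ▷-distrib-+ᵥ : ∀ {n} (x y : Vect n) (L : Mat n) → ((x +ᵥ y) ▷ L) ≈ᵥ ((x ▷ L) +ᵥ (y ▷ L))
  ▷-distrib-+ᵥ x y L j =
    trans (∑-cong (λ i → distribʳ (L i j) (x i) (y i)))
          (∑-distrib-+ (λ i → x i * L i j) (λ i → y i * L i j))

  ▷-distrib-+ₘ : ∀ {n} (x : Vect n) (L M : Mat n) → (x ▷ (L +ₘ M)) ≈ᵥ ((x ▷ L) +ᵥ (x ▷ M))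
  ▷-distrib-+ₘ x L M j =
    trans (∑-cong (λ i → distribˡ (x i) (L i j) (M i j)))
          (∑-distrib-+ (λ i → x i * L i j) (λ i → x i * M i j))

  ▷-·ᵥ : ∀ {n} c (x : Vect n) (L : Mat n) → ((c ·ᵥ x) ▷ L) ≈ᵥ (c ·ᵥ (x ▷ L))
  ▷-·ᵥ c x L j = trans (∑-cong (λ i → *-assoc c (x i) (L i j))) (*-distribˡ-∑ c (λ i → x i * L i j))

  0ᵥ-▷ : ∀ {n} (L : Mat n) → (0ᵥ ▷ L) ≈ᵥ 0ᵥ
  0ᵥ-▷ L j = ∑-zero (λ i → zeroˡ (L i j))

  ▷-0ₘ : ∀ {n} (x : Vect n) → (x ▷ 0ₘ) ≈ᵥ 0ᵥ
  ▷-0ₘ x j = ∑-zero (λ i → zeroʳ (x i))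

  δ-▷ : ∀ {n} (r : Fin n) (L : Mat n) → (δ r ▷ L) ≈ᵥ L r
  δ-▷ r L j = ∑-δˡ r (λ i → L i j)

  U-lin : ∀ {n d} (c : Fin d → F) (b : Fin d → Vect n) → U.lin c b ≈ᵥ (λ j → ∑ λ r → c r * b r j)
  U-lin {d = zero} c b j = refl
  U-lin {d = suc d} c b j = +-congˡ (U-lin (λ i → c (suc i)) (λ i → b (suc i)) j)

  V-lin₁ : ∀ {n d} (c : Fin d → F) (b : Fin d → VPt n) →
           proj₁ (V.lin c b) ≈ᵥ U.lin c (λ r → proj₁ (b r))
  V-lin₁ {d = zero} c b j = refl
  V-lin₁ {d = suc d} c b j = +-congˡ (V-lin₁ (λ i → c (suc i)) (λ i → b (suc i)) j)

  V-lin₂ : ∀ {n d} (c : Fin d → F) (b : Fin d → VPt n) →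
           proj₂ (V.lin c b) ≈ᵥ U.lin c (λ r → proj₂ (b r))
  V-lin₂ {d = zero} c b j = refl
  V-lin₂ {d = suc d} c b j = +-congˡ (V-lin₂ (λ i → c (suc i)) (λ i → b (suc i)) j)

  U-lin-distrib-+ : ∀ {n d} (c c' : Fin d → F) (b : Fin d → Vect n) →
                    U.lin (λ r → c r + c' r) b ≈ᵥ (U.lin c b +ᵥ U.lin c' b)
  U-lin-distrib-+ {d = zero} c c' b j = sym (+-identityˡ 0#)
  U-lin-distrib-+ {d = suc d} c c' b j =
    trans (+-cong (distribʳ (b zero j) (c zero) (c' zero))
                  (U-lin-distrib-+ (λ i → c (suc i)) (λ i → c' (suc i)) (λ i → b (suc i)) j))
          (interchange _ _ _ _)

  U-lin-▷ : ∀ {n d} (c : Fin d → F) (b : Fin d → Vect n) (L : Mat n) →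
            (U.lin c b ▷ L) ≈ᵥ U.lin c (λ r → b r ▷ L)
  U-lin-▷ {d = zero} c b L = 0ᵥ-▷ L
  U-lin-▷ {d = suc d} c b L j = begin
    (((c zero ·ᵥ b zero) +ᵥ rest) ▷ L) j       ≈⟨ ▷-distrib-+ᵥ (c zero ·ᵥ b zero) rest L j ⟩
    ((c zero ·ᵥ b zero) ▷ L) j + (rest ▷ L) j  ≈⟨ +-cong (▷-·ᵥ (c zero) (b zero) L j)
                                                         (U-lin-▷ (λ i → c (suc i)) (λ i → b (suc i)) L j) ⟩
    U.lin c (λ r → b r ▷ L) j                  ∎
    where
    rest = U.lin (λ i → c (suc i)) (λ i → b (suc i))

  U-lin-δ : ∀ {n} (c : Vect n) → U.lin c δ ≈ᵥ c
  U-lin-δ c j = trans (U-lin c δ j) (∑-δʳ c j)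

  U-lin-0ᵥ : ∀ {n d} (c : Fin d → F) → U.lin {n} c (λ _ → 0ᵥ) ≈ᵥ 0ᵥ
  U-lin-0ᵥ c j = trans (U-lin c (λ _ → 0ᵥ) j) (∑-zero (λ r → zeroʳ (c r)))

  V-sumPt₁ : ∀ {n d} (w : Fin d → VPt n) → proj₁ (V.sumPt w) ≈ᵥ (λ j → ∑ λ i → proj₁ (w i) j)
  V-sumPt₁ {d = zero} w j = refl
  V-sumPt₁ {d = suc d} w j = +-congˡ (V-sumPt₁ (λ i → w (suc i)) j)

  V-sumPt₂ : ∀ {n d} (w : Fin d → VPt n) → proj₂ (V.sumPt w) ≈ᵥ (λ j → ∑ λ i → proj₂ (w i) j)
  V-sumPt₂ {d = zero} w j = refl
  V-sumPt₂ {d = suc d} w j = +-congˡ (V-sumPt₂ (λ i → w (suc i)) j)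

  bf-cong : ∀ {n} (B : Mat n) {x x' y y' : Vect n} → x ≈ᵥ x' → y ≈ᵥ y' → bf B x y ≈ bf B x' y'
  bf-cong B x≈x' y≈y' = ∑-cong (λ i → ∑-cong (λ j → *-cong (x≈x' i) (*-congˡ (y≈y' j))))

  bf-congˡ : ∀ {n} (B : Mat n) {x x' : Vect n} (y : Vect n) → x ≈ᵥ x' → bf B x y ≈ bf B x' y
  bf-congˡ B y x≈x' = bf-cong B x≈x' (λ _ → refl)

  bf-congʳ : ∀ {n} (B : Mat n) (x : Vect n) {y y' : Vect n} → y ≈ᵥ y' → bf B x y ≈ bf B x y'
  bf-congʳ B x y≈y' = bf-cong B (λ _ → refl) y≈y'

  bf-zeroˡ : ∀ {n} (B : Mat n) (y : Vect n) → bf B 0ᵥ y ≈ 0#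
  bf-zeroˡ B y = ∑-zero (λ i → ∑-zero (λ j → zeroˡ (B i j * y j)))

  bf-zeroʳ : ∀ {n} (B : Mat n) (x : Vect n) → bf B x 0ᵥ ≈ 0#
  bf-zeroʳ B x = ∑-zero (λ i → ∑-zero (λ j → trans (*-congˡ (zeroʳ (B i j))) (zeroʳ (x i))))

  bf≈∑▷ : ∀ {n} (B : Mat n) (x y : Vect n) → bf B x y ≈ ∑ (λ j → (x ▷ B) j * y j)
  bf≈∑▷ B x y = begin
    bf B x y
      ≈⟨ ∑-comm (λ i j → x i * (B i j * y j)) ⟩
    ∑ (λ j → ∑ (λ i → x i * (B i j * y j)))
      ≈⟨ ∑-cong (λ j → ∑-cong (λ i → sym (*-assoc (x i) (B i j) (y j)))) ⟩
    ∑ (λ j → ∑ (λ i → x i * B i j * y j))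
      ≈⟨ ∑-cong (λ j → *-distribʳ-∑ (y j) (λ i → x i * B i j)) ⟩
    ∑ (λ j → (x ▷ B) j * y j) ∎

  bf-sym : ∀ {n} {B : Mat n} → Symmetric B → ∀ x y → bf B x y ≈ bf B y x
  bf-sym {B = B} symB x y = begin
    bf B x y
      ≈⟨ ∑-comm (λ i j → x i * (B i j * y j)) ⟩
    ∑ (λ j → ∑ (λ i → x i * (B i j * y j)))
      ≈⟨ ∑-cong (λ j → ∑-cong (λ i → swap (x i) (y j) (symB i j))) ⟩
    bf B y x ∎
    where
    swap : ∀ a b {c d} → c ≈ d → a * (c * b) ≈ b * (d * a)
    swap a b {c} {d} c≈d = begin
      a * (c * b)  ≈⟨ *-congˡ (*-cong c≈d refl) ⟩
      a * (d * b)  ≈⟨ *-congˡ (*-comm d b) ⟩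
      a * (b * d)  ≈⟨ *-exchange a b d ⟩
      b * (a * d)  ≈⟨ *-congˡ (*-comm a d) ⟩
      b * (d * a)  ∎

  pointwise-punchIn : ∀ {m} (j₀ : Fin (suc m)) {y y' : Vect (suc m)} → y j₀ ≈ y' j₀ →
                      (∀ k → y (punchIn j₀ k) ≈ y' (punchIn j₀ k)) → y ≈ᵥ y'
  pointwise-punchIn j₀ {y} {y'} at-j₀ off-j₀ j with j₀ ≟ j
  ... | yes ≡.refl = at-j₀
  ... | no j₀≢j = ≡.subst (λ t → y t ≈ y' t) (punchIn-punchOut j₀≢j) (off-j₀ (punchOut j₀≢j))

module GraphSubspaces (R : CommutativeRing 0ℓ 0ℓ) where
  open CommutativeRing R renaming (Carrier to F) hiding (zero)
  open LinAlg R
  open RingLemmas R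
  open import Relation.Binary.Reasoning.Setoid setoid

  Graph : ∀ {n} → (Vect n → Set) → Mat n → VPt n → Set
  Graph P L (x , y) = P x × (y ≈ᵥ (x ▷ L))

  V-HasDim-cong : ∀ {n d} {S S' : VPt n → Set} → V.SameSet S S' → V.HasDim S d → V.HasDim S' d
  V-HasDim-cong (S⊆S' , S'⊆S) (b , indep , S⊆span , span⊆S) =
    b , indep , (λ v v∈S' → S⊆span v (S'⊆S v v∈S')) , (λ v v∈span → S⊆S' v (span⊆S v v∈span))

  standard-basis : ∀ {n} → U.HasDim {n} (λ _ → ⊤) n
  standard-basis = δ , (λ c c≈0 i → trans (sym (U-lin-δ c i)) (c≈0 i)) ,
                   (λ x _ → x , (λ j → sym (U-lin-δ x j))) , (λ _ _ → tt)

  Graph-dim : ∀ {n d} {P : Vect n → Set} (L : Mat n) → U.HasDim P d → V.HasDim (Graph P L) d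
  Graph-dim {P = P} L (b , indep , P⊆span , span⊆P) = b' , indep' , P'⊆span , span⊆P'
    where
    b' : Fin _ → VPt _
    b' r = b r , (b r ▷ L)
    indep' : V.LinIndep b'
    indep' c (lin≈0 , _) = indep c (λ j → trans (sym (V-lin₁ c b' j)) (lin≈0 j))
    P'⊆span : ∀ v → Graph P L v → V.InSpan b' v
    P'⊆span (x , y) (Px , y≈xL) with P⊆span x Px
    ... | c , x≈lin = c , (λ j → trans (x≈lin j) (sym (V-lin₁ c b' j))) , λ j → begin
      y j                          ≈⟨ y≈xL j ⟩
      (x ▷ L) j                    ≈⟨ ▷-congˡ L x≈lin j ⟩
      (U.lin c b ▷ L) j            ≈⟨ U-lin-▷ c b L j ⟩
      U.lin c (λ r → b r ▷ L) j    ≈⟨ V-lin₂ c b' j ⟨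
      proj₂ (V.lin c b') j         ∎
    span⊆P' : ∀ v → V.InSpan b' v → Graph P L v
    span⊆P' (x , y) (c , x≈ , y≈) = span⊆P x (c , x≈lin) , λ j → begin
      y j                          ≈⟨ y≈ j ⟩
      proj₂ (V.lin c b') j         ≈⟨ V-lin₂ c b' j ⟩
      U.lin c (λ r → b r ▷ L) j    ≈⟨ U-lin-▷ c b L j ⟨
      (U.lin c b ▷ L) j            ≈⟨ ▷-congˡ L x≈lin j ⟨
      (x ▷ L) j                    ∎
      where
      x≈lin : x ≈ᵥ U.lin c b
      x≈lin j = trans (x≈ j) (V-lin₁ c b' j)

  VL-dim : ∀ {n} (L : Mat n) → V.HasDim (VL L) n
  VL-dim L = V-HasDim-cong ((λ _ → proj₂) , (λ _ v∈VL → tt , v∈VL)) (Graph-dim L standard-basis)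

  0⊕U-dim : ∀ {n} → V.HasDim (0⊕U {n}) n
  0⊕U-dim = b , indep ,
            (λ { (x , y) x≈0 → y , (λ j → trans (x≈0 j) (sym (first y j))) , (λ j → sym (second y j)) }) ,
            (λ { (x , y) (c , x≈ , _) j → trans (x≈ j) (first c j) })
    where
    b : Fin _ → VPt _
    b r = 0ᵥ , δ r
    first : ∀ c → proj₁ (V.lin c b) ≈ᵥ 0ᵥ
    first c j = trans (V-lin₁ c b j) (U-lin-0ᵥ c j)
    second : ∀ c → proj₂ (V.lin c b) ≈ᵥ c
    second c j = trans (V-lin₂ c b j) (U-lin-δ c j)
    indep : V.LinIndep b
    indep c (_ , lin≈0) i = trans (sym (second c i)) (lin≈0 i)

  VL-injective : ∀ {n} {L M : Mat n} → V.SameSet (VL L) (VL M) → L ≈ₘ M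
  VL-injective {L = L} {M} (VL⊆VM , _) r j = begin
    L r j          ≈⟨ δ-▷ r L j ⟨
    (δ r ▷ L) j    ≈⟨ VL⊆VM (δ r , (δ r ▷ L)) (λ _ → refl) j ⟩
    (δ r ▷ M) j    ≈⟨ δ-▷ r M j ⟩
    M r j          ∎

  VL∩0⊕U : ∀ {n} (L : Mat n) v → VL L v → 0⊕U v → v ≅V 0V
  VL∩0⊕U L (x , y) y≈xL x≈0 = x≈0 , λ j → trans (y≈xL j) (trans (▷-congˡ L x≈0 j) (0ᵥ-▷ L j))

  0⊕U≉VL : ∀ {n} → ¬ (1# ≈ 0#) → (L : Mat (suc n)) → ¬ V.SameSet 0⊕U (VL L)
  0⊕U≉VL 1≉0 L (0⊕U⊆VL , _) = 1≉0 (trans (0⊕U⊆VL (0ᵥ , δ zero) (λ _ → refl) zero) (0ᵥ-▷ L zero))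

  withVertical-distinct : ∀ {n N} → ¬ (1# ≈ 0#) → (Ξ : Fin N → Mat (suc n)) →
                          (∀ i j → Ξ i ≈ₘ Ξ j → i ≡ j) → Distinct (withVertical Ξ)
  withVertical-distinct 1≉0 Ξ Ξ-inj zero zero _ = ≡.refl
  withVertical-distinct 1≉0 Ξ Ξ-inj zero (suc j) same = contradiction same (0⊕U≉VL 1≉0 (Ξ j))
  withVertical-distinct 1≉0 Ξ Ξ-inj (suc i) zero (VL⊆ , ⊆VL) = contradiction (⊆VL , VL⊆) (0⊕U≉VL 1≉0 (Ξ i))
  withVertical-distinct 1≉0 Ξ Ξ-inj (suc i) (suc j) same = ≡.cong suc (Ξ-inj i j (VL-injective same))

  VL-totallySingular : ∀ {n} (B L : Mat n) → SkewSymmetric B L → ∀ v → VL L v → Qf B v ≈ 0#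
  VL-totallySingular B L (_ , alternating) (x , y) y≈xL =
    trans (bf-congʳ B x y≈xL) (alternating x)

  0⊕U-totallySingular : ∀ {n} (B : Mat n) v → 0⊕U v → Qf B v ≈ 0#
  0⊕U-totallySingular B (x , y) x≈0 = trans (bf-congˡ B y x≈0) (bf-zeroˡ B y)

module Characteristic2 (R : CommutativeRing 0ℓ 0ℓ) (char2 : LinAlg.Char2 R) where
  open CommutativeRing R renaming (Carrier to F) hiding (zero)
  open LinAlg R
  open RingLemmas R
  open import Relation.Binary.Reasoning.Setoid setoid
  open import Algebra.Properties.CommutativeSemigroup +-commutativeSemigroup
    using () renaming (x∙yz≈y∙xz to +-exchange)

  x+x≈0 : ∀ x → x + x ≈ 0#
  x+x≈0 x = begin
    x + x            ≈⟨ sym (+-cong (*-identityˡ x) (*-identityˡ x)) ⟩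
    1# * x + 1# * x  ≈⟨ sym (distribʳ x 1# 1#) ⟩
    (1# + 1#) * x    ≈⟨ *-congʳ char2 ⟩
    0# * x           ≈⟨ zeroˡ x ⟩
    0#               ∎

  x+y≈0⇒x≈y : ∀ {x y} → x + y ≈ 0# → x ≈ y
  x+y≈0⇒x≈y {x} {y} x+y≈0 = begin
    x            ≈⟨ sym (+-identityʳ x) ⟩
    x + 0#       ≈⟨ +-congˡ (sym (x+x≈0 y)) ⟩
    x + (y + y)  ≈⟨ sym (+-assoc x y y) ⟩
    (x + y) + y  ≈⟨ +-congʳ x+y≈0 ⟩
    0# + y       ≈⟨ +-identityˡ y ⟩
    y            ∎

  -x≈x : ∀ x → - x ≈ x
  -x≈x x = x+y≈0⇒x≈y (-‿inverseˡ x)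

  x+y+y≈x : ∀ x y → x + (y + y) ≈ x
  x+y+y≈x x y = trans (+-congˡ (x+x≈0 y)) (+-identityʳ x)

  U-lin-injective : ∀ {n d} {b : Fin d → Vect n} → U.LinIndep b →
                    ∀ {c c'} → U.lin c b ≈ᵥ U.lin c' b → ∀ r → c r ≈ c' r
  U-lin-injective {b = b} indep {c} {c'} lin≈lin r = x+y≈0⇒x≈y (indep (λ r → c r + c' r)
    (λ j → trans (U-lin-distrib-+ c c' b j) (trans (+-congʳ (lin≈lin j)) (x+x≈0 _))) r)

  sgn≈1 : ∀ {n} (j : Fin n) → sgn j ≈ 1#
  sgn≈1 zero = refl
  sgn≈1 (suc j) = trans (-‿cong (sgn≈1 j)) (-x≈x 1#)

  permanent : ∀ {n} → Mat n → F
  permanent {zero} M = 1#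
  permanent {suc n} M = ∑ λ j → M zero j * permanent (λ r c → M (suc r) (punchIn j c))

  permanent-cong : ∀ {n} {M N : Mat n} → M ≈ₘ N → permanent M ≈ permanent N
  permanent-cong {zero} M≈N = refl
  permanent-cong {suc n} M≈N =
    ∑-cong (λ j → *-cong (M≈N zero j) (permanent-cong (λ r c → M≈N (suc r) (punchIn j c))))

  det≈permanent : ∀ {n} (M : Mat n) → det M ≈ permanent M
  det≈permanent {zero} M = refl
  det≈permanent {suc n} M = ∑-cong {f = λ j → sgn j * (M zero j * det (minor j))}
                                    {g = λ j → M zero j * permanent (minor j)} λ j →
    trans (*-cong (sgn≈1 j) (*-congˡ (det≈permanent (minor j)))) (*-identityˡ _)
    where
    minor : Fin (suc n) → Mat n
    minor j r c = M (suc r) (punchIn j c)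

  Extensional : ∀ {m k} → ((Fin m → Fin k) → F) → Set
  Extensional Φ = ∀ σ τ → (∀ c → σ c ≡ τ c) → Φ σ ≈ Φ τ

  -- Laplace expansion along two rows a and b, with Φ the minor on the remaining columns.
  expand₂ : ∀ m → (a b : Fin (suc (suc m)) → F) → ((Fin m → Fin (suc (suc m))) → F) → F
  expand₂ m a b Φ = ∑ λ j → ∑ λ k → a j * (b (punchIn j k) * Φ (λ c → punchIn j (punchIn k c)))

  expand₂-base : ∀ a b Φ → Extensional Φ →
                 expand₂ 0 a b Φ ≈ a zero * (b (suc zero) * Φ (λ ())) + a (suc zero) * (b zero * Φ (λ ()))
  expand₂-base a b Φ ext = +-cong
    (trans (+-identityʳ _) (*-congˡ (*-congˡ (ext _ _ (λ ())))))
    (trans (+-identityʳ _) (trans (+-identityʳ _) (*-congˡ (*-congˡ (ext _ _ (λ ()))))))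

  firstColumnTerms : ∀ m → (a b : Fin (suc (suc (suc m))) → F) →
                     ((Fin (suc m) → Fin (suc (suc (suc m)))) → F) → F
  firstColumnTerms m a b Φ = ∑ λ k → a zero * (b (suc k) * Φ (λ c → suc (punchIn k c)))

  expand₂-step : ∀ m a b Φ → Extensional Φ →
    expand₂ (suc m) a b Φ ≈
      firstColumnTerms m a b Φ + (firstColumnTerms m b a Φ
        + expand₂ m (λ j → a (suc j)) (λ j → b (suc j)) (λ σ → Φ (lift 1 σ)))
  expand₂-step m a b Φ ext = +-congˡ (begin
    ∑ (λ j → a (suc j) * (b zero * Φ (col j)) + rest j)
      ≈⟨ ∑-distrib-+ (λ j → a (suc j) * (b zero * Φ (col j))) rest ⟩
    ∑ (λ j → a (suc j) * (b zero * Φ (col j))) + ∑ rest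
      ≈⟨ +-cong (∑-cong (λ j → *-exchange (a (suc j)) (b zero) (Φ (col j))))
                (∑-cong {f = rest} (λ j → ∑-cong {f = restTerm j}
                  (λ k → *-congˡ (*-congˡ (ext _ _ (shift j k)))))) ⟩
    firstColumnTerms m b a Φ + expand₂ m (λ j → a (suc j)) (λ j → b (suc j)) (λ σ → Φ (lift 1 σ)) ∎)
    where
    col : Fin (suc (suc m)) → Fin (suc m) → Fin (suc (suc (suc m)))
    col j c = suc (punchIn j c)
    restTerm : Fin (suc (suc m)) → Fin (suc m) → F
    restTerm j k = a (suc j) * (b (suc (punchIn j k)) * Φ (λ c → punchIn (suc j) (punchIn (suc k) c)))
    rest : Fin (suc (suc m)) → F
    rest j = ∑ (restTerm j)
    shift : ∀ j k c → punchIn (suc j) (punchIn (suc k) c) ≡ lift 1 (λ c → punchIn j (punchIn k c)) c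
    shift j k zero = ≡.refl
    shift j k (suc c) = ≡.refl

  Extensional-lift : ∀ {m k} {Φ : (Fin (suc m) → Fin (suc k)) → F} →
                     Extensional Φ → Extensional (λ σ → Φ (lift 1 σ))
  Extensional-lift ext σ τ σ≗τ = ext _ _ λ { zero → ≡.refl ; (suc c) → ≡.cong suc (σ≗τ c) }

  expand₂-comm : ∀ m a b Φ → Extensional Φ → expand₂ m a b Φ ≈ expand₂ m b a Φ
  expand₂-comm zero a b Φ ext = begin
    expand₂ 0 a b Φ
      ≈⟨ expand₂-base a b Φ ext ⟩
    a zero * (b (suc zero) * Φ (λ ())) + a (suc zero) * (b zero * Φ (λ ()))
      ≈⟨ trans (+-comm _ _) (+-cong (*-exchange _ _ _) (*-exchange _ _ _)) ⟩
    b zero * (a (suc zero) * Φ (λ ())) + b (suc zero) * (a zero * Φ (λ ()))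
      ≈⟨ sym (expand₂-base b a Φ ext) ⟩
    expand₂ 0 b a Φ ∎
  expand₂-comm (suc m) a b Φ ext = begin
    expand₂ (suc m) a b Φ
      ≈⟨ expand₂-step m a b Φ ext ⟩
    firstColumnTerms m a b Φ + (firstColumnTerms m b a Φ + expand₂ m a' b' Φ')
      ≈⟨ +-exchange _ _ _ ⟩
    firstColumnTerms m b a Φ + (firstColumnTerms m a b Φ + expand₂ m a' b' Φ')
      ≈⟨ +-congˡ (+-congˡ (expand₂-comm m a' b' Φ' (Extensional-lift ext))) ⟩
    firstColumnTerms m b a Φ + (firstColumnTerms m a b Φ + expand₂ m b' a' Φ')
      ≈⟨ sym (expand₂-step m b a Φ ext) ⟩
    expand₂ (suc m) b a Φ ∎
    where
    a' = λ j → a (suc j)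
    b' = λ j → b (suc j)
    Φ' = λ σ → Φ (lift 1 σ)

  expand₂-diag : ∀ m a Φ → Extensional Φ → expand₂ m a a Φ ≈ 0#
  expand₂-diag zero a Φ ext =
    trans (expand₂-base a a Φ ext) (trans (+-congˡ (*-exchange _ _ _)) (x+x≈0 _))
  expand₂-diag (suc m) a Φ ext = begin
    expand₂ (suc m) a a Φ
      ≈⟨ expand₂-step m a a Φ ext ⟩
    firstColumnTerms m a a Φ + (firstColumnTerms m a a Φ + expand₂ m a' a' (λ σ → Φ (lift 1 σ)))
      ≈⟨ +-congˡ (+-congˡ (expand₂-diag m a' _ (Extensional-lift ext))) ⟩
    firstColumnTerms m a a Φ + (firstColumnTerms m a a Φ + 0#)
      ≈⟨ trans (+-congˡ (+-identityʳ _)) (x+x≈0 _) ⟩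
    0# ∎
    where
    a' = λ j → a (suc j)

  lowerMinor : ∀ {n} → (Fin (suc n) → Vect (suc (suc n))) → (Fin n → Fin (suc (suc n))) → F
  lowerMinor K σ = permanent (λ r c → K (suc r) (σ c))

  permanent-∷ : ∀ {n} (w : Vect (suc (suc n))) (K : Fin (suc n) → Vect (suc (suc n))) →
                permanent (w ∷ K) ≈ expand₂ n w (K zero) (lowerMinor K)
  permanent-∷ {n} w K = ∑-cong {f = λ j → w j * permanent (minor j)} λ j →
    sym (*-distribˡ-∑ (w j) (λ k → K zero (punchIn j k) * lowerMinor K (σ j k)))
    where
    minor : Fin (suc (suc n)) → Mat (suc n)
    minor j r c = K r (punchIn j c)
    σ : Fin (suc (suc n)) → Fin (suc n) → Fin n → Fin (suc (suc n))
    σ j k c = punchIn j (punchIn k c)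

  lowerMinor-extensional : ∀ {n} (K : Fin (suc n) → Vect (suc (suc n))) → Extensional (lowerMinor K)
  lowerMinor-extensional K σ τ σ≗τ = permanent-cong (λ r c → reflexive (≡.cong (K (suc r)) (σ≗τ c)))

  -- For a repeated lower row, expand along row 0 first: the repeated row then reappears in every minor.
  permanent-repeated-row : ∀ {n} (K : Fin (suc n) → Vect (suc (suc n))) r → permanent (K r ∷ K) ≈ 0#
  permanent-repeated-row {n} K zero =
    trans (permanent-∷ (K zero) K) (expand₂-diag n (K zero) (lowerMinor K) (lowerMinor-extensional K))
  permanent-repeated-row {suc n} K (suc r) = begin
    permanent (K (suc r) ∷ K)
      ≈⟨ permanent-∷ (K (suc r)) K ⟩
    expand₂ (suc n) (K (suc r)) (K zero) (lowerMinor K)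
      ≈⟨ expand₂-comm (suc n) (K (suc r)) (K zero) (lowerMinor K) (lowerMinor-extensional K) ⟩
    expand₂ (suc n) (K zero) (K (suc r)) (lowerMinor K)
      ≈⟨ ∑-cong {g = λ j → K zero j * permanent (minor j r ∷ minor j)}
                (λ j → *-distribˡ-∑ (K zero j) (λ k → K (suc r) (punchIn j k) * lowerMinor K (σ j k))) ⟩
    ∑ (λ j → K zero j * permanent (minor j r ∷ minor j))
      ≈⟨ ∑-zero {f = λ j → K zero j * permanent (minor j r ∷ minor j)}
                (λ j → trans (*-congˡ (permanent-repeated-row (minor j) r)) (zeroʳ _)) ⟩
    0# ∎
    where
    minor : Fin (suc (suc (suc n))) → Fin (suc n) → Vect (suc (suc n))
    minor j r c = K (suc r) (punchIn j c)
    σ : Fin (suc (suc (suc n))) → Fin (suc (suc n)) → Fin (suc n) → Fin (suc (suc (suc n)))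
    σ j k c = punchIn j (punchIn k c)

module GraphsInCharacteristic2 (R : CommutativeRing 0ℓ 0ℓ) (char2 : LinAlg.Char2 R) where
  open CommutativeRing R renaming (Carrier to F) hiding (zero)
  open LinAlg R
  open RingLemmas R
  open Characteristic2 R char2
  open GraphSubspaces R
  open import Relation.Binary.Reasoning.Setoid setoid

  ker-+ₘ⇒agree : ∀ {n} {L M : Mat n} {x} → ker (L +ₘ M) x → (x ▷ L) ≈ᵥ (x ▷ M)
  ker-+ₘ⇒agree {L = L} {M} {x} x∈ker j = x+y≈0⇒x≈y (trans (sym (▷-distrib-+ₘ x L M j)) (x∈ker j))

  agree⇒ker-+ₘ : ∀ {n} {L M : Mat n} {x} → (x ▷ L) ≈ᵥ (x ▷ M) → ker (L +ₘ M) x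
  agree⇒ker-+ₘ {L = L} {M} {x} xL≈xM j =
    trans (▷-distrib-+ₘ x L M j) (trans (+-congʳ (xL≈xM j)) (x+x≈0 _))

  common-point⇒ker-+ₘ : ∀ {n} {L M : Mat n} {x y} → VL L (x , y) → VL M (x , y) → ker (L +ₘ M) x
  common-point⇒ker-+ₘ y≈xL y≈xM = agree⇒ker-+ₘ (λ j → trans (sym (y≈xL j)) (y≈xM j))

  -- V(L) ∩ V(M) is the graph of L over ker (L + M).
  VL∩VL-dim : ∀ {n d} (L M : Mat n) → U.HasDim (ker (L +ₘ M)) d → V.HasDim (V._∩_ (VL L) (VL M)) d
  VL∩VL-dim L M ker-dim = V-HasDim-cong
    ( (λ { (x , y) (x∈ker , y≈xL) → y≈xL , (λ j → trans (y≈xL j) (ker-+ₘ⇒agree x∈ker j)) })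
    , (λ { (x , y) (y≈xL , y≈xM) → common-point⇒ker-+ₘ {L = L} {M} y≈xL y≈xM , y≈xL }))
    (Graph-dim L ker-dim)

  VL-totallyIsotropic : ∀ {n} (B L : Mat n) → SelfAdjoint B L →
                        ∀ v w → VL L v → VL L w → alt B v w ≈ 0#
  VL-totallyIsotropic B L selfAdj (x , y) (x' , y') y≈xL y'≈x'L = begin
    bf B x y' + bf B y x'                  ≈⟨ +-cong (bf-congʳ B x y'≈x'L) (bf-congˡ B x' y≈xL) ⟩
    bf B x (x' ▷ L) + bf B (x ▷ L) x'      ≈⟨ +-congˡ (selfAdj x x') ⟩
    bf B x (x' ▷ L) + bf B x (x' ▷ L)      ≈⟨ x+x≈0 _ ⟩
    0#                                     ∎

  0⊕U-totallyIsotropic : ∀ {n} (B : Mat n) → ∀ v w → 0⊕U v → 0⊕U w → alt B v w ≈ 0#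
  0⊕U-totallyIsotropic B (x , y) (x' , y') x≈0 x'≈0 =
    trans (+-cong (trans (bf-congˡ B y' x≈0) (bf-zeroˡ B y'))
                  (trans (bf-congʳ B y x'≈0) (bf-zeroʳ B y)))
          (+-identityˡ 0#)

  VL⊕0⊕U : ∀ {n} (L : Mat n) v → ∃ λ x → ∃ λ y → VL L x × 0⊕U y × (v ≅V (x +V y))
  VL⊕0⊕U L (a , b) = (a , (a ▷ L)) , (0ᵥ , ((a ▷ L) +ᵥ b)) , (λ _ → refl) , (λ _ → refl) ,
                     (λ j → sym (+-identityʳ (a j))) ,
                     (λ j → sym (trans (sym (+-assoc _ _ _)) (trans (+-congʳ (x+x≈0 _)) (+-identityˡ (b j)))))

injective⇒surjective : ∀ {n} (f : Fin n → Fin n) → Injective _≡_ _≡_ f → ∀ y → ∃ λ i → f i ≡ y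
injective⇒surjective {suc n} f f-inj y with any? (λ i → f i ≟ y)
... | yes hit = hit
... | no miss = contradiction (injective⇒≤ g-inj) ℕ.1+n≰n
  where
  g : Fin (suc n) → Fin n
  g i = punchOut {i = y} {j = f i} (λ y≡fi → miss (i , ≡.sym y≡fi))
  g-inj : Injective _≡_ _≡_ g
  g-inj {i} {j} gi≡gj = f-inj (punchOut-injective {i = y} _ _ gi≡gj)

injective-family-onto : ∀ {N} {A : Set} (_∼_ : A → A → Set) (P : A → Set) (code : A → Fin N) →
  (∀ {a b} → P a → P b → code a ≡ code b → a ∼ b) →
  (f : Fin N → A) → (∀ i → P (f i)) → (∀ {i j} → f i ∼ f j → i ≡ j) →
  ∀ {a} → P a → ∃ λ i → f i ∼ a
injective-family-onto _∼_ P code code-inj f f∈P f-inj {a} a∈P =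
  let i , code-fi≡code-a = injective⇒surjective (λ i → code (f i))
                                                 (λ eq → f-inj (code-inj (f∈P _) (f∈P _) eq)) (code a)
  in i , code-inj (f∈P i) a∈P code-fi≡code-a

module FiniteRing (R : CommutativeRing 0ℓ 0ℓ) {q : ℕ} (card : LinAlg.HasCard R q) where
  open CommutativeRing R renaming (Carrier to F) hiding (zero)
  open LinAlg R

  private
    elem : Fin q → F
    elem = proj₁ card

    elem-inj : ∀ i j → elem i ≈ elem j → i ≡ j
    elem-inj = proj₁ (proj₂ card)

    index : F → Fin q
    index x = proj₁ (proj₂ (proj₂ card) x)

    elem-index : ∀ x → elem (index x) ≈ x
    elem-index x = proj₂ (proj₂ (proj₂ card) x)

    index-cong : ∀ {x y} → x ≈ y → index x ≡ index y
    index-cong {x} {y} x≈y = elem-inj _ _ (trans (elem-index x) (trans x≈y (sym (elem-index y))))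

    index-injective : ∀ {x y} → index x ≡ index y → x ≈ y
    index-injective {x} {y} eq = trans (sym (elem-index x)) (trans (reflexive (≡.cong elem eq)) (elem-index y))

  _≟F_ : Decidable _≈_
  x ≟F y with index x ≟ index y
  ... | yes eq = yes (index-injective eq)
  ... | no neq = no (λ x≈y → neq (index-cong x≈y))

  _≟0ᵥ : ∀ {n} (x : Vect n) → Dec (x ≈ᵥ 0ᵥ)
  x ≟0ᵥ = all? (λ j → x j ≟F 0#)

  nonzero-coordinate : ∀ {n} (x : Vect n) → ¬ (x ≈ᵥ 0ᵥ) → ∃ λ r → NonZeroF (x r)
  nonzero-coordinate {n} x = ¬∀⟶∃¬ n (λ j → x j ≈ 0#) (λ j → x j ≟F 0#)

  encode : ∀ {m} → Vect m → Fin (q ^ m)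
  encode {zero} x = zero
  encode {suc m} x = combine (index (x zero)) (encode (λ i → x (suc i)))

  decode : ∀ {m} → Fin (q ^ m) → Vect m
  decode {suc m} k zero = elem (proj₁ (remQuot {q} (q ^ m) k))
  decode {suc m} k (suc i) = decode (proj₂ (remQuot {q} (q ^ m) k)) i

  encode-cong : ∀ {m} {x y : Vect m} → x ≈ᵥ y → encode x ≡ encode y
  encode-cong {zero} x≈y = ≡.refl
  encode-cong {suc m} x≈y = ≡.cong₂ combine (index-cong (x≈y zero)) (encode-cong (λ i → x≈y (suc i)))

  encode-injective : ∀ {m} {x y : Vect m} → encode x ≡ encode y → x ≈ᵥ y
  encode-injective {suc m} {x} {y} eq zero =
    index-injective (combine-injectiveˡ (index (x zero)) _ (index (y zero)) _ eq)
  encode-injective {suc m} {x} {y} eq (suc i) =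
    encode-injective (combine-injectiveʳ (index (x zero)) _ (index (y zero)) _ eq) i

  encode-decode : ∀ {m} (k : Fin (q ^ m)) → encode (decode {m} k) ≡ k
  encode-decode {zero} zero = ≡.refl
  encode-decode {suc m} k =
    ≡.trans (≡.cong₂ combine (elem-inj _ _ (elem-index _))
                             (encode-decode {m} (proj₂ (remQuot {q} (q ^ m) k))))
            (combine-remQuot {q} (q ^ m) k)

  decode-injective : ∀ {m} {k l : Fin (q ^ m)} → decode {m} k ≈ᵥ decode l → k ≡ l
  decode-injective {m} {k} {l} k≈l =
    ≡.trans (≡.sym (encode-decode {m} k)) (≡.trans (encode-cong {m} k≈l) (encode-decode {m} l))

module FieldLemmas (R : CommutativeRing 0ℓ 0ℓ) (isField : IsField R) where
  open CommutativeRing R renaming (Carrier to F) hiding (zero)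
  open LinAlg R
  open RingLemmas R
  open IsField isField using (inv)
  open import Relation.Binary.Reasoning.Setoid setoid
  open import Algebra.Properties.Group +-group using () renaming (∙-cancelʳ to +-cancelʳ)

  *-cancelˡ-nonzero : ∀ {a x y} → NonZeroF a → a * x ≈ a * y → x ≈ y
  *-cancelˡ-nonzero {a} {x} {y} a≉0 ax≈ay = let b , ab≈1 = inv a a≉0 in begin
    x            ≈⟨ sym (*-identityˡ x) ⟩
    1# * x       ≈⟨ *-congʳ (trans (sym ab≈1) (*-comm a b)) ⟩
    (b * a) * x  ≈⟨ *-assoc b a x ⟩
    b * (a * x)  ≈⟨ *-congˡ ax≈ay ⟩
    b * (a * y)  ≈⟨ sym (*-assoc b a y) ⟩
    (b * a) * y  ≈⟨ *-congʳ (trans (*-comm b a) ab≈1) ⟩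
    1# * y       ≈⟨ *-identityˡ y ⟩
    y            ∎

  nonzero-*-zero : ∀ {a x} → NonZeroF a → a * x ≈ 0# → x ≈ 0#
  nonzero-*-zero {a} a≉0 ax≈0 = *-cancelˡ-nonzero a≉0 (trans ax≈0 (sym (zeroʳ a)))

  hyperplane-coordinates : ∀ {m} (u : Vect (suc m)) (j₀ : Fin (suc m)) → NonZeroF (u j₀) →
    ∀ {y y'} → ∑ (λ j → u j * y j) ≈ ∑ (λ j → u j * y' j) →
    (∀ k → y (punchIn j₀ k) ≈ y' (punchIn j₀ k)) → y ≈ᵥ y'
  hyperplane-coordinates u j₀ u₀≉0 {y} {y'} uy≈uy' off-j₀ =
    pointwise-punchIn j₀ (*-cancelˡ-nonzero u₀≉0 (+-cancelʳ (rest y) _ _ (begin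
      u j₀ * y j₀ + rest y    ≈⟨ sym (∑-punchIn j₀ (λ j → u j * y j)) ⟩
      ∑ (λ j → u j * y j)     ≈⟨ uy≈uy' ⟩
      ∑ (λ j → u j * y' j)    ≈⟨ ∑-punchIn j₀ (λ j → u j * y' j) ⟩
      u j₀ * y' j₀ + rest y'  ≈⟨ +-congˡ (∑-cong (λ k → *-congˡ (sym (off-j₀ k)))) ⟩
      u j₀ * y' j₀ + rest y   ∎))) off-j₀
    where
    rest : Vect (suc _) → F
    rest z = ∑ λ k → u (punchIn j₀ k) * z (punchIn j₀ k)

  Span : ∀ {n} → Vect n → Vect n → Set
  Span p v = ∃ λ c → v ≈ᵥ (c ·ᵥ p)

  Span-dim : ∀ {n} (p : Vect n) r → NonZeroF (p r) → U.HasDim (Span p) 1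
  Span-dim p r pr≉0 = (λ _ → p) , indep ,
    (λ v (c , v≈cp) → (λ _ → c) , λ j → trans (v≈cp j) (sym (+-identityʳ _))) ,
    (λ v (c , v≈lin) → c zero , λ j → trans (v≈lin j) (+-identityʳ _))
    where
    indep : U.LinIndep (λ _ → p)
    indep c lin≈0 zero =
      nonzero-*-zero pr≉0 (trans (*-comm (p r) (c zero)) (trans (sym (+-identityʳ _)) (lin≈0 r)))

module NonsingularDeterminant (R : CommutativeRing 0ℓ 0ℓ) (isField : IsField R) (char2 : LinAlg.Char2 R)
                              (_≟F_ : Decidable (CommutativeRing._≈_ R)) where
  open CommutativeRing R renaming (Carrier to F) hiding (zero)
  open LinAlg R
  open RingLemmas R
  open Characteristic2 R char2
  open FieldLemmas R isField
  open import Relation.Binary.Reasoning.Setoid setoid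

  cofactor : ∀ {n} → Mat (suc n) → Fin (suc n) → F
  cofactor M j = permanent (λ r c → M (suc r) (punchIn j c))

  expansion-along-lower-row : ∀ {n} (M : Mat (suc n)) (i : Fin n) →
                              ∑ (λ j → M (suc i) j * cofactor M j) ≈ 0#
  expansion-along-lower-row {suc n} M i = permanent-repeated-row (λ r → M (suc r)) i

  expansion-along-combination : ∀ {n} (M : Mat (suc n)) (x : Vect (suc n)) →
                                ∑ (λ j → (x ▷ M) j * cofactor M j) ≈ x zero * permanent M
  expansion-along-combination M x = begin
    ∑ (λ j → (x zero * M zero j + lower j) * cofactor M j)
      ≈⟨ ∑-cong (λ j → distribʳ (cofactor M j) (x zero * M zero j) (lower j)) ⟩
    ∑ (λ j → x zero * M zero j * cofactor M j + lower j * cofactor M j)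
      ≈⟨ ∑-distrib-+ (λ j → x zero * M zero j * cofactor M j) (λ j → lower j * cofactor M j) ⟩
    ∑ (λ j → x zero * M zero j * cofactor M j) + ∑ (λ j → lower j * cofactor M j)
      ≈⟨ +-cong (trans (∑-cong (λ j → *-assoc (x zero) (M zero j) (cofactor M j)))
                       (*-distribˡ-∑ (x zero) (λ j → M zero j * cofactor M j)))
                lower-vanishes ⟩
    x zero * permanent M + 0#
      ≈⟨ +-identityʳ _ ⟩
    x zero * permanent M ∎
    where
    lower : Fin _ → F
    lower j = ∑ λ i → x (suc i) * M (suc i) j
    lower-vanishes : ∑ (λ j → lower j * cofactor M j) ≈ 0#
    lower-vanishes = begin
      ∑ (λ j → lower j * cofactor M j)
        ≈⟨ ∑-cong (λ j → trans (sym (*-distribʳ-∑ (cofactor M j) (λ i → x (suc i) * M (suc i) j)))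
                               (∑-cong (λ i → *-assoc (x (suc i)) (M (suc i) j) (cofactor M j)))) ⟩
      ∑ (λ j → ∑ (λ i → x (suc i) * (M (suc i) j * cofactor M j)))
        ≈⟨ ∑-comm (λ j i → x (suc i) * (M (suc i) j * cofactor M j)) ⟩
      ∑ (λ i → ∑ (λ j → x (suc i) * (M (suc i) j * cofactor M j)))
        ≈⟨ ∑-zero (λ i → trans (*-distribˡ-∑ (x (suc i)) (λ j → M (suc i) j * cofactor M j))
                               (trans (*-congˡ (expansion-along-lower-row M i)) (zeroʳ _))) ⟩
      0# ∎

  -- If x₀ ≠ 0, expanding along the row combination x M = 0 gives x₀ · perm M = 0;
  -- if x₀ = 0, the rest of x lies in the kernel of every minor of the first row.
  ker≉0⇒permanent≈0 : ∀ {n} (M : Mat n) (x : Vect n) → (x ▷ M) ≈ᵥ 0ᵥ →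
                      ∀ r → NonZeroF (x r) → permanent M ≈ 0#
  ker≉0⇒permanent≈0 {suc n} M x xM≈0 r xr≉0 with x zero ≟F 0#
  ... | no x₀≉0 = nonzero-*-zero x₀≉0 (begin
    x zero * permanent M                ≈⟨ sym (expansion-along-combination M x) ⟩
    ∑ (λ j → (x ▷ M) j * cofactor M j)  ≈⟨ ∑-zero {f = λ j → (x ▷ M) j * cofactor M j}
                                                  (λ j → trans (*-congʳ (xM≈0 j)) (zeroˡ _)) ⟩
    0#                                  ∎)
  ker≉0⇒permanent≈0 {suc n} M x xM≈0 zero xr≉0 | yes x₀≈0 = contradiction x₀≈0 xr≉0
  ker≉0⇒permanent≈0 {suc n} M x xM≈0 (suc r) xr≉0 | yes x₀≈0 =
    ∑-zero {f = λ j → M zero j * permanent (minor j)} λ j →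
      trans (*-congˡ (ker≉0⇒permanent≈0 (minor j) (λ i → x (suc i)) (minor-kernel j) r xr≉0)) (zeroʳ _)
    where
    minor : Fin (suc n) → Mat n
    minor j r c = M (suc r) (punchIn j c)
    minor-kernel : ∀ j → ((λ i → x (suc i)) ▷ minor j) ≈ᵥ 0ᵥ
    minor-kernel j c = begin
      ∑ (λ i → x (suc i) * M (suc i) (punchIn j c))
        ≈⟨ sym (+-identityˡ _) ⟩
      0# + ∑ (λ i → x (suc i) * M (suc i) (punchIn j c))
        ≈⟨ +-congʳ (sym (trans (*-congʳ x₀≈0) (zeroˡ _))) ⟩
      x zero * M zero (punchIn j c) + ∑ (λ i → x (suc i) * M (suc i) (punchIn j c))
        ≈⟨ xM≈0 (punchIn j c) ⟩
      0# ∎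

  det≉0⇒ker≈0 : ∀ {n} (M : Mat n) → NonZeroF (det M) → ∀ x → (x ▷ M) ≈ᵥ 0ᵥ → x ≈ᵥ 0ᵥ
  det≉0⇒ker≈0 M det≉0 x xM≈0 r with x r ≟F 0#
  ... | yes xr≈0 = xr≈0
  ... | no xr≉0 = contradiction (trans (det≈permanent M) (ker≉0⇒permanent≈0 M x xM≈0 r xr≉0)) det≉0

module Spreads (R : CommutativeRing 0ℓ 0ℓ) (isField : IsField R) (char2 : LinAlg.Char2 R)
               {q : ℕ} (card : LinAlg.HasCard R q) where
  open CommutativeRing R renaming (Carrier to F) hiding (zero)
  open LinAlg R
  open RingLemmas R
  open Characteristic2 R char2 using (U-lin-injective)
  open FiniteRing R card
  open FieldLemmas R isField
  open NonsingularDeterminant R isField char2 _≟F_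
  open GraphSubspaces R
  open GraphsInCharacteristic2 R char2
  open IsField isField using (1≉0)

  NonsingularDifferences : ∀ {n N} → (Fin N → Mat n) → Set
  NonsingularDifferences Ξ = ∀ i j → i ≢ j → NonZeroF (det (Ξ i +ₘ Ξ j))

  same-image⇒same-index : ∀ {n N} (Ξ : Fin N → Mat n) → NonsingularDifferences Ξ →
                          ∀ {x} → ¬ (x ≈ᵥ 0ᵥ) → ∀ {i j} → (x ▷ Ξ i) ≈ᵥ (x ▷ Ξ j) → i ≡ j
  same-image⇒same-index Ξ nonsingular {x} x≉0 {i} {j} xΞi≈xΞj with i ≟ j
  ... | yes i≡j = i≡j
  ... | no i≢j =
    contradiction (det≉0⇒ker≈0 (Ξ i +ₘ Ξ j) (nonsingular i j i≢j) x (agree⇒ker-+ₘ xΞi≈xΞj)) x≉0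

  withVertical-dim : ∀ {n N} (Ξ : Fin N → Mat n) i → V.HasDim (withVertical Ξ i) n
  withVertical-dim Ξ zero = 0⊕U-dim
  withVertical-dim Ξ (suc i) = VL-dim (Ξ i)

  withVertical-totallyIsotropic : ∀ {n N} (B : Mat n) (Ξ : Fin N → Mat n) → (∀ i → SelfAdjoint B (Ξ i)) →
                                  ∀ i v w → withVertical Ξ i v → withVertical Ξ i w → alt B v w ≈ 0#
  withVertical-totallyIsotropic B Ξ selfAdj zero = 0⊕U-totallyIsotropic B
  withVertical-totallyIsotropic B Ξ selfAdj (suc i) = VL-totallyIsotropic B (Ξ i) (selfAdj i)

  withVertical-totallySingular : ∀ {n N} (B : Mat n) (Ξ : Fin N → Mat n) → (∀ i → SkewSymmetric B (Ξ i)) →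
                                 ∀ i v → withVertical Ξ i v → Qf B v ≈ 0#
  withVertical-totallySingular B Ξ skew zero = 0⊕U-totallySingular B
  withVertical-totallySingular B Ξ skew (suc i) = VL-totallySingular B (Ξ i) (skew i)

  withVertical-unique : ∀ {n N} (Ξ : Fin N → Mat n) → NonsingularDifferences Ξ →
                        ∀ v i j → ¬ (v ≅V 0V) → withVertical Ξ i v → withVertical Ξ j v → i ≡ j
  withVertical-unique Ξ nonsingular v zero zero v≉0 _ _ = ≡.refl
  withVertical-unique Ξ nonsingular v zero (suc j) v≉0 v∈0⊕U v∈VL =
    contradiction (VL∩0⊕U (Ξ j) v v∈VL v∈0⊕U) v≉0
  withVertical-unique Ξ nonsingular v (suc i) zero v≉0 v∈VL v∈0⊕U =
    contradiction (VL∩0⊕U (Ξ i) v v∈VL v∈0⊕U) v≉0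
  withVertical-unique Ξ nonsingular (x , y) (suc i) (suc j) v≉0 y≈xΞi y≈xΞj with x ≟0ᵥ
  ... | yes x≈0 = contradiction (VL∩0⊕U (Ξ i) (x , y) y≈xΞi x≈0) v≉0
  ... | no x≉0 =
    ≡.cong suc (same-image⇒same-index Ξ nonsingular x≉0 (λ t → trans (sym (y≈xΞi t)) (y≈xΞj t)))

  -- Each nonzero x makes i ↦ x Ξᵢ an injection of the q^n indices into the q^n vectors.
  VL-cover : ∀ {n} (Ξ : Fin (q ^ n) → Mat n) → NonsingularDifferences Ξ →
             ∀ {x} → ¬ (x ≈ᵥ 0ᵥ) → ∀ y → ∃ λ i → (x ▷ Ξ i) ≈ᵥ y
  VL-cover Ξ nonsingular {x} x≉0 y =
    injective-family-onto _≈ᵥ_ (λ _ → ⊤) encode (λ _ _ → encode-injective) (λ i → x ▷ Ξ i) (λ _ → tt)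
                          (same-image⇒same-index Ξ nonsingular x≉0) tt

  withVertical-cover : ∀ {n} (Ξ : Fin (q ^ n) → Mat n) → NonsingularDifferences Ξ →
                       ∀ v → ¬ (v ≅V 0V) → ∃ λ i → withVertical Ξ i v
  withVertical-cover Ξ nonsingular (x , y) v≉0 with x ≟0ᵥ
  ... | yes x≈0 = zero , x≈0
  ... | no x≉0 = let i , xΞi≈y = VL-cover Ξ nonsingular x≉0 y in suc i , λ t → sym (xΞi≈y t)

  symplecticSpread : ∀ {n} (B : Mat (suc n)) (Ξ : Fin (q ^ suc n) → Mat (suc n)) →
    (∀ i j → Ξ i ≈ₘ Ξ j → i ≡ j) → (∀ i → SelfAdjoint B (Ξ i)) → NonsingularDifferences Ξ →
    SymplecticSpread q B (withVertical Ξ)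
  symplecticSpread {n} B Ξ Ξ-inj selfAdj nonsingular =
    ℕ.+-comm 1 (q ^ suc n) , withVertical-distinct 1≉0 Ξ Ξ-inj , withVertical-dim Ξ ,
    withVertical-totallyIsotropic B Ξ selfAdj , withVertical-cover Ξ nonsingular ,
    withVertical-unique Ξ nonsingular

  module Orthogonal {m : ℕ} (B : Mat (suc m)) (nondegenerate : Nondegenerate B) where

    ▷B-nonzero : ∀ {x} → ¬ (x ≈ᵥ 0ᵥ) → ¬ ((x ▷ B) ≈ᵥ 0ᵥ)
    ▷B-nonzero {x} x≉0 xB≈0 = x≉0 (nondegenerate x λ y →
      trans (bf≈∑▷ B x y) (∑-zero (λ j → trans (*-congʳ (xB≈0 j)) (zeroˡ (y j)))))

    -- x^⊥ is coordinatised by the coordinates off a pivot of x B, hence has q^m elements.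
    orthogonal-code : ∀ {x} → ¬ (x ≈ᵥ 0ᵥ) → ∃ λ (code : Vect (suc m) → Fin (q ^ m)) →
      ∀ {y y'} → bf B x y ≈ 0# → bf B x y' ≈ 0# → code y ≡ code y' → y ≈ᵥ y'
    orthogonal-code {x} x≉0 = code , code-injective
      where
      pivot = nonzero-coordinate (x ▷ B) (▷B-nonzero x≉0)
      code : Vect (suc m) → Fin (q ^ m)
      code y = encode (λ k → y (punchIn (proj₁ pivot) k))
      code-injective : ∀ {y y'} → bf B x y ≈ 0# → bf B x y' ≈ 0# → code y ≡ code y' → y ≈ᵥ y'
      code-injective {y} {y'} bxy≈0 bxy'≈0 eq =
        hyperplane-coordinates (x ▷ B) (proj₁ pivot) (proj₂ pivot)
          (trans (sym (bf≈∑▷ B x y)) (trans bxy≈0 (trans (sym bxy'≈0) (bf≈∑▷ B x y'))))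
          (encode-injective eq)

    -- By counting: both have q^m elements.
    orthogonal-subspace-full : ∀ {x} → ¬ (x ≈ᵥ 0ᵥ) → ∀ {W : Vect (suc m) → Set} → U.HasDim W m →
      (∀ w → W w → bf B x w ≈ 0#) → ∀ {y} → bf B x y ≈ 0# → W y
    orthogonal-subspace-full {x} x≉0 {W} (b , indep , _ , span⊆W) W⊥x {y} bxy≈0 =
      span⊆W y (decode i , λ j → sym (fi≈y j))
      where
      f : Fin (q ^ m) → Vect (suc m)
      f k = U.lin (decode k) b
      f⊥x : ∀ k → bf B x (f k) ≈ 0#
      f⊥x k = W⊥x (f k) (span⊆W (f k) (decode k , λ _ → refl))
      hit = let code , code-injective = orthogonal-code x≉0 in
            injective-family-onto _≈ᵥ_ (λ y → bf B x y ≈ 0#) code code-injective f f⊥x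
                                  (λ fk≈fl → decode-injective (U-lin-injective indep fk≈fl)) bxy≈0
      i = proj₁ hit
      fi≈y = proj₂ hit

    VL-cover-singular : (Ξ : Fin (q ^ m) → Mat (suc m)) → NonsingularDifferences Ξ →
      (∀ i → SkewSymmetric B (Ξ i)) → ∀ {x} → ¬ (x ≈ᵥ 0ᵥ) → ∀ {y} → bf B x y ≈ 0# →
      ∃ λ i → (x ▷ Ξ i) ≈ᵥ y
    VL-cover-singular Ξ nonsingular skew {x} x≉0 =
      let code , code-injective = orthogonal-code x≉0 in
      injective-family-onto _≈ᵥ_ (λ y → bf B x y ≈ 0#) code code-injective
                            (λ i → x ▷ Ξ i) (λ i → proj₂ (skew i) x)
                            (same-image⇒same-index Ξ nonsingular x≉0)

    withVertical-cover-singular : (Ξ : Fin (q ^ m) → Mat (suc m)) → NonsingularDifferences Ξ →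
      (∀ i → SkewSymmetric B (Ξ i)) → ∀ v → ¬ (v ≅V 0V) → Qf B v ≈ 0# → ∃ λ i → withVertical Ξ i v
    withVertical-cover-singular Ξ nonsingular skew (x , y) v≉0 Qv≈0 with x ≟0ᵥ
    ... | yes x≈0 = zero , x≈0
    ... | no x≉0 =
      let i , xΞi≈y = VL-cover-singular Ξ nonsingular skew x≉0 Qv≈0 in suc i , λ t → sym (xΞi≈y t)

    orthogonalSpread : (Ξ : Fin (q ^ m) → Mat (suc m)) → (∀ i j → Ξ i ≈ₘ Ξ j → i ≡ j) →
      NonsingularDifferences Ξ → (∀ i → SkewSymmetric B (Ξ i)) → OrthogonalSpread B (withVertical Ξ)
    orthogonalSpread Ξ Ξ-inj nonsingular skew =
      withVertical-distinct 1≉0 Ξ Ξ-inj , withVertical-dim Ξ , withVertical-totallySingular B Ξ skew ,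
      withVertical-cover-singular Ξ nonsingular skew ,
      λ v i j v≉0 _ → withVertical-unique Ξ nonsingular v i j v≉0

Fin-zero-or-other : ∀ k → (∀ (t : Fin (suc k)) → t ≡ zero) ⊎ (∃ λ (t : Fin (suc k)) → t ≢ zero)
Fin-zero-or-other zero = inj₁ λ { zero → ≡.refl }
Fin-zero-or-other (suc k) = inj₂ (suc zero , λ ())

module DualHyperovals (R : CommutativeRing 0ℓ 0ℓ) (isField : IsField R) (char2 : LinAlg.Char2 R)
                      (card : LinAlg.HasCard R 2) where
  open CommutativeRing R renaming (Carrier to F) hiding (zero)
  open LinAlg R
  open RingLemmas R
  open Characteristic2 R char2
  open FiniteRing R card
  open FieldLemmas R isField
  open GraphSubspaces R
  open GraphsInCharacteristic2 R char2
  open Spreads R isField char2 card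
  open IsField isField using (1≉0)
  open import Relation.Binary.Reasoning.Setoid setoid
  open import Algebra.Properties.CommutativeSemigroup +-commutativeSemigroup
    using () renaming (x∙yz≈y∙xz to +-exchange)

  nonzero≈1 : ∀ {c} → NonZeroF c → c ≈ 1#
  nonzero≈1 {c} c≉0 with proj₂ (proj₂ card) 0# | proj₂ (proj₂ card) 1# | proj₂ (proj₂ card) c
  ... | zero , e≈0 | zero , e≈1 | _ = contradiction (trans (sym e≈1) e≈0) 1≉0
  ... | suc zero , e≈0 | suc zero , e≈1 | _ = contradiction (trans (sym e≈1) e≈0) 1≉0
  ... | zero , e≈0 | suc zero , _ | zero , e≈c = contradiction (trans (sym e≈c) e≈0) c≉0
  ... | zero , _ | suc zero , e≈1 | suc zero , e≈c = trans (sym e≈c) e≈1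
  ... | suc zero , _ | zero , e≈1 | zero , e≈c = trans (sym e≈c) e≈1
  ... | suc zero , e≈0 | zero , _ | suc zero , e≈c = contradiction (trans (sym e≈c) e≈0) c≉0

  Span-nonzero : ∀ {n} {p x : Vect n} → ¬ (x ≈ᵥ 0ᵥ) → Span p x → x ≈ᵥ p
  Span-nonzero {p = p} x≉0 (c , x≈cp) with c ≟F 0#
  ... | yes c≈0 = contradiction (λ s → trans (x≈cp s) (trans (*-congʳ c≈0) (zeroˡ (p s)))) x≉0
  ... | no c≉0 = λ s → trans (x≈cp s) (trans (*-congʳ (nonzero≈1 c≉0)) (*-identityˡ (p s)))

  ∈Span-self : ∀ {n} (p : Vect n) → Span p p
  ∈Span-self p = 1# , λ s → sym (*-identityˡ (p s))

  -- t ≢ zero witnesses dimension ≥ 2.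
  nonzero-orthogonal : ∀ {k} (u : Vect (suc k)) {t : Fin (suc k)} → t ≢ zero →
                       ∃ λ p → ∃ λ r → NonZeroF (p r) × ∑ (λ j → u j * p j) ≈ 0#
  nonzero-orthogonal u {t} t≢0 with u zero ≟F 0#
  ... | yes u₀≈0 = (λ j → δ j zero) , zero , 1≉0 , trans (∑-δʳ u zero) u₀≈0
  ... | no u₀≉0 = p , t , pt≉0 , (begin
    ∑ (λ j → u j * (u t * δ j zero + u zero * δ j t))
      ≈⟨ ∑-cong (λ j → trans (distribˡ (u j) _ _) (+-cong (*-exchange (u j) (u t) (δ j zero))
                                                           (*-exchange (u j) (u zero) (δ j t)))) ⟩
    ∑ (λ j → u t * (u j * δ j zero) + u zero * (u j * δ j t))
      ≈⟨ ∑-distrib-+ (λ j → u t * (u j * δ j zero)) (λ j → u zero * (u j * δ j t)) ⟩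
    ∑ (λ j → u t * (u j * δ j zero)) + ∑ (λ j → u zero * (u j * δ j t))
      ≈⟨ +-cong (trans (*-distribˡ-∑ (u t) (λ j → u j * δ j zero)) (*-congˡ (∑-δʳ u zero)))
                (trans (*-distribˡ-∑ (u zero) (λ j → u j * δ j t)) (*-congˡ (∑-δʳ u t))) ⟩
    u t * u zero + u zero * u t
      ≈⟨ trans (+-congˡ (*-comm (u zero) (u t))) (x+x≈0 _) ⟩
    0# ∎)
    where
    p : Vect (suc _)
    p j = u t * δ j zero + u zero * δ j t
    pt≉0 : NonZeroF (p t)
    pt≉0 pt≈0 = u₀≉0 (begin
      u zero                             ≈⟨ sym (trans (+-cong (trans (*-congˡ (δ-off t≢0)) (zeroʳ _))
                                                               (trans (*-congˡ (δ-diag t)) (*-identityʳ _)))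
                                                       (+-identityˡ _)) ⟩
      u t * δ t zero + u zero * δ t t    ≈⟨ pt≈0 ⟩
      0#                                 ∎)

  module Hyperoval {m : ℕ} (B : Mat (suc m)) (symB : Symmetric B) (nondegenerate : Nondegenerate B)
    (Ξ : Fin (2 ^ suc m) → Mat (suc m)) (Ξ-inj : ∀ i j → Ξ i ≈ₘ Ξ j → i ≡ j)
    (selfAdj : ∀ i → SelfAdjoint B (Ξ i)) (z : Fin (2 ^ suc m)) (Ξz≈0 : Ξ z ≈ₘ 0ₘ)
    (rank : ∀ i j → i ≢ j → HasRank (Ξ i +ₘ Ξ j) m)
    (kernels : ∀ i → (∀ j → i ≢ j → U.HasDim (ker (Ξ i +ₘ Ξ j)) 1)
                   × (∀ (P : Vect (suc m) → Set) → U.HasDim P 1 →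
                        ∃ λ j → i ≢ j × U.SameSet P (ker (Ξ i +ₘ Ξ j)))) where
    open Orthogonal B nondegenerate

    ▷-Ξz+ : ∀ a j → (a ▷ (Ξ z +ₘ Ξ j)) ≈ᵥ (a ▷ Ξ j)
    ▷-Ξz+ a j t = trans (▷-distrib-+ₘ a (Ξ z) (Ξ j) t)
                        (trans (+-congʳ (trans (▷-congʳ a Ξz≈0 t) (▷-0ₘ a t))) (+-identityˡ _))

    annihilating-index : ∀ {p} r → NonZeroF (p r) → ∃ λ j → z ≢ j × (p ▷ Ξ j) ≈ᵥ 0ᵥ
    annihilating-index {p} r pr≉0 =
      let j , z≢j , (Span⊆ker , _) = proj₂ (kernels z) (Span p) (Span-dim p r pr≉0)
      in j , z≢j , λ t → trans (sym (▷-Ξz+ p j t)) (Span⊆ker p (∈Span-self p) t)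

    -- In dimension 1 an index j ≠ z with δ₀ Ξⱼ = 0 would give Ξⱼ = 0 = Ξ_z.
    second-index : ∃ λ (t : Fin (suc m)) → t ≢ zero
    second-index with Fin-zero-or-other m
    ... | inj₂ t = t
    ... | inj₁ only-zero =
      let j , z≢j , δ₀Ξj≈0 = annihilating-index {δ zero} zero 1≉0
          Ξj≈Ξz : Ξ j ≈ₘ Ξ z
          Ξj≈Ξz r c = ≡.subst₂ (λ r c → Ξ j r c ≈ Ξ z r c) (≡.sym (only-zero r)) (≡.sym (only-zero c))
                               (trans (sym (δ-▷ zero (Ξ j) zero)) (trans (δ₀Ξj≈0 zero) (sym (Ξz≈0 zero zero))))
      in contradiction (≡.sym (Ξ-inj j z Ξj≈Ξz)) z≢j

    -- Choose p ≠ 0 orthogonal to y and j with p Ξⱼ = 0: the image of Ξⱼ is an m-dimensional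
    -- subspace of p^⊥, hence all of it.
    image-cover : ∀ y → ∃ λ j → ∃ λ a → y ≈ᵥ (a ▷ Ξ j)
    image-cover y = j , a , λ s → trans (y≈ s) (▷-Ξz+ a j s)
      where
      orth = nonzero-orthogonal (y ▷ B) (proj₂ second-index)
      p = proj₁ orth
      r = proj₁ (proj₂ orth)
      pr≉0 = proj₁ (proj₂ (proj₂ orth))
      bpy≈0 : bf B p y ≈ 0#
      bpy≈0 = trans (bf-sym symB p y) (trans (bf≈∑▷ B y p) (proj₂ (proj₂ (proj₂ orth))))
      annihilating = annihilating-index {p} r pr≉0
      j = proj₁ annihilating
      z≢j = proj₁ (proj₂ annihilating)
      pΞj≈0 = proj₂ (proj₂ annihilating)
      image⊥p : ∀ w → (∃ λ a → w ≈ᵥ (a ▷ (Ξ z +ₘ Ξ j))) → bf B p w ≈ 0#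
      image⊥p w (a , w≈) = begin
        bf B p w            ≈⟨ bf-congʳ B p (λ s → trans (w≈ s) (▷-Ξz+ a j s)) ⟩
        bf B p (a ▷ Ξ j)    ≈⟨ bf-sym symB p (a ▷ Ξ j) ⟩
        bf B (a ▷ Ξ j) p    ≈⟨ selfAdj j a p ⟩
        bf B a (p ▷ Ξ j)    ≈⟨ bf-congʳ B a pΞj≈0 ⟩
        bf B a 0ᵥ           ≈⟨ bf-zeroʳ B a ⟩
        0#                  ∎
      image = orthogonal-subspace-full {p} (λ p≈0 → pr≉0 (p≈0 r)) (rank z j z≢j) image⊥p bpy≈0
      a = proj₁ image
      y≈ = proj₂ image

    δz-kills : ∀ i (c : Vect (suc m)) s → δ z i * (c ▷ Ξ i) s ≈ 0#
    δz-kills i c s with z ≟ i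
    ... | yes ≡.refl = trans (*-congˡ (trans (▷-congʳ c Ξz≈0 s) (▷-0ₘ c s))) (zeroʳ _)
    ... | no z≢i = trans (*-congʳ (δ-off z≢i)) (zeroˡ _)

    -- (x, y) = (a, a Ξ_j) + (x + a, 0), and (x + a, 0) lies in V(Ξ_z) = U ⊕ 0.
    members-span : ∀ v → ∃ λ (w : Fin (2 ^ suc m) → VPt (suc m)) → (∀ i → VL (Ξ i) (w i)) × (v ≅V V.sumPt w)
    members-span (x , y) = w , w∈VL , (λ s → sym (first s)) , (λ s → sym (second s))
      where
      j = proj₁ (image-cover y)
      a = proj₁ (proj₂ (image-cover y))
      x+a = x +ᵥ a
      w : Fin (2 ^ suc m) → VPt (suc m)
      w i = ((δ j i ·ᵥ a) +ᵥ (δ z i ·ᵥ x+a)) , (δ j i ·ᵥ (a ▷ Ξ i))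
      w∈VL : ∀ i → VL (Ξ i) (w i)
      w∈VL i s = sym (begin
        (((δ j i ·ᵥ a) +ᵥ (δ z i ·ᵥ x+a)) ▷ Ξ i) s
          ≈⟨ ▷-distrib-+ᵥ (δ j i ·ᵥ a) (δ z i ·ᵥ x+a) (Ξ i) s ⟩
        ((δ j i ·ᵥ a) ▷ Ξ i) s + ((δ z i ·ᵥ x+a) ▷ Ξ i) s
          ≈⟨ +-cong (▷-·ᵥ (δ j i) a (Ξ i) s) (▷-·ᵥ (δ z i) x+a (Ξ i) s) ⟩
        δ j i * (a ▷ Ξ i) s + δ z i * (x+a ▷ Ξ i) s
          ≈⟨ +-congˡ (δz-kills i x+a s) ⟩
        δ j i * (a ▷ Ξ i) s + 0#
          ≈⟨ +-identityʳ _ ⟩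
        δ j i * (a ▷ Ξ i) s ∎)
      first : proj₁ (V.sumPt w) ≈ᵥ x
      first s = begin
        proj₁ (V.sumPt w) s
          ≈⟨ V-sumPt₁ w s ⟩
        ∑ (λ i → δ j i * a s + δ z i * x+a s)
          ≈⟨ ∑-distrib-+ (λ i → δ j i * a s) (λ i → δ z i * x+a s) ⟩
        ∑ (λ i → δ j i * a s) + ∑ (λ i → δ z i * x+a s)
          ≈⟨ +-cong (∑-δˡ j (λ _ → a s)) (∑-δˡ z (λ _ → x+a s)) ⟩
        a s + (x s + a s)
          ≈⟨ +-exchange (a s) (x s) (a s) ⟩
        x s + (a s + a s)
          ≈⟨ x+y+y≈x (x s) (a s) ⟩
        x s ∎
      second : proj₂ (V.sumPt w) ≈ᵥ y
      second s = begin
        proj₂ (V.sumPt w) s              ≈⟨ V-sumPt₂ w s ⟩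
        ∑ (λ i → δ j i * (a ▷ Ξ i) s)    ≈⟨ ∑-δˡ j (λ i → (a ▷ Ξ i) s) ⟩
        (a ▷ Ξ j) s                      ≈⟨ proj₂ (proj₂ (image-cover y)) s ⟨
        y s                              ∎

    -- Sending each nonzero x to the index j with ker (Ξᵢ + Ξⱼ) = ⟨x⟩, and 0 to i, injects Fin 2ⁿ into itself.
    module Lines (i : Fin (2 ^ suc m)) where
      point : Fin (2 ^ suc m) → Vect (suc m)
      point = decode

      point-injective : ∀ {k l} → point k ≈ᵥ point l → k ≡ l
      point-injective = decode-injective {suc m}

      LineIndex : Fin (2 ^ suc m) → Fin (2 ^ suc m) → Set
      LineIndex k j = (point k ≈ᵥ 0ᵥ × j ≡ i)
                    ⊎ (¬ (point k ≈ᵥ 0ᵥ) × i ≢ j × U.SameSet (Span (point k)) (ker (Ξ i +ₘ Ξ j)))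

      lineIndex : ∀ k → ∃ (LineIndex k)
      lineIndex k with point k ≟0ᵥ
      ... | yes k≈0 = i , inj₁ (k≈0 , ≡.refl)
      ... | no k≉0 =
        let r , kr≉0 = nonzero-coordinate (point k) k≉0
            j , i≢j , same = proj₂ (kernels i) (Span (point k)) (Span-dim (point k) r kr≉0)
        in j , inj₂ (k≉0 , i≢j , same)

      line : Fin (2 ^ suc m) → Fin (2 ^ suc m)
      line k = proj₁ (lineIndex k)

      line-injective : ∀ {k l} → line k ≡ line l → k ≡ l
      line-injective {k} {l} eq with lineIndex k | lineIndex l
      ... | _ , inj₁ (k≈0 , _) | _ , inj₁ (l≈0 , _) = point-injective (λ s → trans (k≈0 s) (sym (l≈0 s)))
      ... | _ , inj₁ (_ , j≡i) | _ , inj₂ (_ , i≢j' , _) = contradiction (≡.trans (≡.sym j≡i) eq) i≢j'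
      ... | _ , inj₂ (_ , i≢j , _) | _ , inj₁ (_ , j'≡i) =
        contradiction (≡.trans (≡.sym j'≡i) (≡.sym eq)) i≢j
      ... | _ , inj₂ (k≉0 , _ , (Spank⊆ker , _)) | _ , inj₂ (_ , _ , (_ , ker⊆Spanl)) with eq
      ...   | ≡.refl = point-injective (Span-nonzero k≉0
                         (ker⊆Spanl (point k) (Spank⊆ker (point k) (∈Span-self (point k)))))

      line-contains : ∀ {x} → ¬ (x ≈ᵥ 0ᵥ) → ∀ k {j} → line k ≡ j → i ≢ j → ker (Ξ i +ₘ Ξ j) x → x ≈ᵥ point k
      line-contains x≉0 k eq i≢j x∈ker with lineIndex k
      ... | _ , inj₁ (_ , j≡i) = contradiction (≡.trans (≡.sym j≡i) eq) i≢j
      ... | _ , inj₂ (_ , _ , (_ , ker⊆Span)) with eq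
      ...   | ≡.refl = Span-nonzero x≉0 (ker⊆Span _ x∈ker)

      kernel-determines-index : ∀ {x} → ¬ (x ≈ᵥ 0ᵥ) → ∀ {j l} → i ≢ j → i ≢ l →
                                ker (Ξ i +ₘ Ξ j) x → ker (Ξ i +ₘ Ξ l) x → j ≡ l
      kernel-determines-index x≉0 {j} {l} i≢j i≢l x∈kerj x∈kerl =
        ≡.trans (≡.sym linek≡j) (≡.trans (≡.cong line k≡k') linek'≡l)
        where
        k = proj₁ (injective⇒surjective line line-injective j)
        linek≡j = proj₂ (injective⇒surjective line line-injective j)
        k' = proj₁ (injective⇒surjective line line-injective l)
        linek'≡l = proj₂ (injective⇒surjective line line-injective l)
        k≡k' = point-injective (λ s → trans (sym (line-contains x≉0 k linek≡j i≢j x∈kerj s))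
                                             (line-contains x≉0 k' linek'≡l i≢l x∈kerl s))

    triple-meet : ∀ i j l → i ≢ j → j ≢ l → i ≢ l →
                  ∀ v → VL (Ξ i) v → VL (Ξ j) v → VL (Ξ l) v → v ≅V 0V
    triple-meet i j l i≢j j≢l i≢l (x , y) v∈i v∈j v∈l with x ≟0ᵥ
    ... | yes x≈0 = VL∩0⊕U (Ξ i) (x , y) v∈i x≈0
    ... | no x≉0 = contradiction (Lines.kernel-determines-index i x≉0 i≢j i≢l
                                    (common-point⇒ker-+ₘ {L = Ξ i} {Ξ j} {x} v∈i v∈j)
                                    (common-point⇒ker-+ₘ {L = Ξ i} {Ξ l} {x} v∈i v∈l)) j≢l

    orthogonalDualHyperoval : (∀ i → SkewSymmetric B (Ξ i)) →
      OrthogonalDualHyperoval B (λ i → VL (Ξ i)) × SplitsOver (λ i → VL (Ξ i)) 0⊕U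
    orthogonalDualHyperoval skew =
      ( ( ≡.refl , (λ i j same → Ξ-inj i j (VL-injective same)) , (λ i → VL-dim (Ξ i)) , members-span
        , (λ i j i≢j → VL∩VL-dim (Ξ i) (Ξ j) (proj₁ (kernels i) j i≢j)) , triple-meet )
      , (λ i → VL-totallySingular B (Ξ i) (skew i)) )
      , λ i → VL⊕0⊕U (Ξ i) , VL∩0⊕U (Ξ i)

open import Data.Nat using (_+_; _*_)

lemma3p2 : (R : CommutativeRing 0ℓ 0ℓ) → IsField R →
    let open LinAlg R in
    (q : ℕ) → HasCard q → (∃ λ m → q ≡ 2 ^ m) → Char2 →
    (n : ℕ) → 1 ≤ n →
    (B : Mat n) → Symmetric B → Nondegenerate B →
    ((Ξ : Fin (q ^ n) → Mat n) →
       (∀ i j → Ξ i ≈ₘ Ξ j → i ≡ j) →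
       (∀ i → SelfAdjoint B (Ξ i)) →
       (∃ λ i → Ξ i ≈ₘ 0ₘ) →
       (∀ i j → i ≢ j → NonZeroF (det (Ξ i +ₘ Ξ j))) →
       SymplecticSpread q B (withVertical Ξ))
    ×
    ((Ξ : Fin (q ^ (n ∸ 1)) → Mat n) →
       (∀ i j → Ξ i ≈ₘ Ξ j → i ≡ j) →
       (∀ i → SelfAdjoint B (Ξ i)) →
       (∃ λ i → Ξ i ≈ₘ 0ₘ) →
       (∀ i j → i ≢ j → NonZeroF (det (Ξ i +ₘ Ξ j))) →
       (∀ i → SkewSymmetric B (Ξ i)) →
       OrthogonalSpread B (withVertical Ξ))
    ×
    (q ≡ 2 → (∃ λ k → n ≡ 1 + 2 * k) →
     (Ξ : Fin (2 ^ n) → Mat n) →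
       (∀ i j → Ξ i ≈ₘ Ξ j → i ≡ j) →
       (∀ i → SelfAdjoint B (Ξ i)) →
       (∃ λ i → Ξ i ≈ₘ 0ₘ) →
       (∀ i → SkewSymmetric B (Ξ i)) →
       (∀ i j → i ≢ j → HasRank (Ξ i +ₘ Ξ j) (n ∸ 1)) →
       (∀ i →
          (∀ j → i ≢ j → U.HasDim (ker (Ξ i +ₘ Ξ j)) 1)
        × (∀ (P : Vect n → Set) → U.HasDim P 1 →
             ∃ λ j → i ≢ j × U.SameSet P (ker (Ξ i +ₘ Ξ j)))) →
       OrthogonalDualHyperoval B (λ i → VL (Ξ i)) × SplitsOver (λ i → VL (Ξ i)) 0⊕U)
-- Not needed: 0 ∈ Ξ in (a) and (b), q being a power of 2 beyond characteristic 2, and n odd in (c).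
lemma3p2 R isField q card _ char2 (suc m) (s≤s z≤n) B symB nondegenerate =
    (λ Ξ Ξ-inj selfAdj _ nonsingular → symplecticSpread B Ξ Ξ-inj selfAdj nonsingular)
  , (λ Ξ Ξ-inj _ _ nonsingular skew → orthogonalSpread Ξ Ξ-inj nonsingular skew)
  , λ q≡2 _ Ξ Ξ-inj selfAdj (z , Ξz≈0) skew rank kernels →
      let open DualHyperovals R isField char2 (≡.subst (LinAlg.HasCard R) q≡2 card) in
      Hyperoval.orthogonalDualHyperoval B symB nondegenerate Ξ Ξ-inj selfAdj z Ξz≈0 rank kernels skew
  where
  open Spreads R isField char2 card
  open Orthogonal B nondegenerate
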